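{- Let $n$ be a nonnegative integer and let $x,y$ be complex numbers for which all the expressions below are defined. Then \[ \sum_{k=0}^{n}(-1)^k\binom{n}{k}\frac{\binom{2x+k}{k}\binom{2y+k}{k}}{\binom{2x+n+k}{k}\binom{2x-2y+k}{k}} \frac{1+2x+2k}{1+2x+n+k}H_{k}(x) =\frac{1}{2}\frac{\binom{2x+n}{n}\binom{x-2y-1+n}{n}}{\binom{x+n}{n}\binom{2x-2y+n}{n}}\big\{H_n(x)-H_{n}(x-2y-1)\big\}. \]
   Context: For a complex number $z$ and a nonnegative integer $t$, $\binom{z}{t}=\frac{z(z-1)\cdots(z-t+1)}{t!}$ (with $\binom{z}{0}=1$). For complex $x$, $H_0(x)=0$ and $H_m(x)=\sum_{j=1}^m\frac{1}{x+j}$ for $m\ge1$. -}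

module Defs where

open import Level using (Level; _⊔_) renaming (suc to lsuc)
open import Algebra.Bundles using (CommutativeRing)
open import Data.Nat as ℕ using (ℕ; zero; suc)
open import Data.Nat.Combinatorics using (_C_)
open import Data.Nat using (_!)
open import Relation.Nullary using (¬_)

ιR : ∀ {c ℓ} (R : CommutativeRing c ℓ) → ℕ → CommutativeRing.Carrier R
ιR R zero    = CommutativeRing.0# R
ιR R (suc n) = CommutativeRing._+_ R (CommutativeRing.1# R) (ιR R n)

-- The stdlib has no Field bundle, so we package: a commutative ring, a
-- total inverse map whose value at 0 is irrelevant, the inverse law for
-- nonzero elements, and characteristic zero (1+1+...+1 ≠ 0).
record CharZeroField c ℓ : Set (lsuc (c ⊔ ℓ)) where
  field
    commutativeRing : CommutativeRing c ℓ
  open CommutativeRing commutativeRing public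
  field
    _⁻¹      : Carrier → Carrier
    inverseʳ : ∀ x → ¬ (x ≈ 0#) → x * (x ⁻¹) ≈ 1#
    charZero : ∀ n → ¬ (ιR commutativeRing (suc n) ≈ 0#)
  ι : ℕ → Carrier
  ι = ιR commutativeRing

module FieldOps {c ℓ} (F : CharZeroField c ℓ) where
  open CharZeroField F

  infixl 7 _÷_
  _÷_ : Carrier → Carrier → Carrier
  a ÷ b = a * (b ⁻¹)

  sum0to : ℕ → (ℕ → Carrier) → Carrier
  sum0to zero    f = f 0
  sum0to (suc n) f = sum0to n f + f (suc n)

  falling : Carrier → ℕ → Carrier
  falling z zero    = 1#
  falling z (suc t) = falling z t * (z - ι t)

  binom : Carrier → ℕ → Carrier
  binom z t = falling z t ÷ ι (t !)

  H : ℕ → Carrier → Carrier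
  H zero    x = 0#
  H (suc m) x = H m x + (x + ι (suc m)) ⁻¹

  sgn : ℕ → Carrier
  sgn zero    = 1#
  sgn (suc k) = - sgn k

  choose : ℕ → ℕ → Carrier
  choose n k = ι (n C k)

-- Multiplying the k-th summand by W = (2x+n+1)(2x+n+2)⋯(2x+2n+1) clears its denominators, so the
-- left-hand side is S(n)/W with S(n) = Σₖ τ(n,k) Hₖ(x) for a hypergeometric term τ. Creative
-- telescoping supplies certificates G with c₁(n) τ(n+1,k) − c₀(n) τ(n,k) = G(k+1) − G(k), where
-- G(k+1) is (x+k+1) times a term v(n,k); summation by parts against Hₖ(x), whose increments are
-- 1/(x+k+1), leaves the harmonic-free sum V(n) = Σₖ v(n,k):
--   c₁(n) S(n+1) = c₀(n) S(n) − (2x+2n+3) V(n).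
-- V itself satisfies a homogeneous first-order recurrence (again by a certificate), hence is a
-- product, and induction on n turns the inhomogeneous recurrence into the closed form for S(n),
-- whose harmonic part is Hₙ(x) − Hₙ(x−2y−1).

module Submission where

open import Defs
open import Data.Nat using (ℕ; suc; _≤_)
open import Relation.Nullary using (¬_)

open import Algebra.Bundles using (CommutativeRing)
open import Data.Nat as ℕ using (zero; _<_; z≤n; s≤s; _∸_; _!)
import Data.Nat.Properties as ℕP
open import Data.Nat.Solver using (module +-*-Solver)
open import Data.Nat.Combinatorics using (_C_; nCk+nC[k+1]≡[n+1]C[k+1]; k>n⇒nCk≡0; nCn≡1; nC1≡n)
open import Data.Integer as ℤ using (ℤ; +_; -[1+_]; _⊖_; _◃_)
import Data.Integer.Properties as ℤP
open import Data.Sign as Sign using ()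
open import Data.Product using (_×_; _,_)
open import Data.Sum using (inj₁; inj₂)
open import Data.Vec using (Vec)
import Relation.Binary.PropositionalEquality as P

-- Ring solver with integer constants; the constant n is interpreted through ιR,
-- so that it evaluates to ι n definitionally.
module IntegerCoefficientSolver {c ℓ} (R : CommutativeRing c ℓ) where
  open CommutativeRing R
  open import Relation.Binary.Reasoning.Setoid setoid
  open import Algebra.Properties.Ring ring using (-‿distribˡ-*; -‿distribʳ-*)
  open import Algebra.Properties.Group +-group using (⁻¹-involutive; ε⁻¹≈ε)
  open import Algebra.Properties.AbelianGroup +-abelianGroup using (⁻¹-∙-comm)
  open import Data.Bool using (Bool; true; false; T)
  open import Data.Maybe using (nothing)
  open import Tactic.RingSolver.Core.AlmostCommutativeRing using (fromCommutativeRing)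
  open import Tactic.RingSolver.Core.Polynomial.Parameters using (Homomorphism)

  ιR-+ : ∀ m n → ιR R (m ℕ.+ n) ≈ ιR R m + ιR R n
  ιR-+ zero    n = sym (+-identityˡ _)
  ιR-+ (suc m) n = trans (+-congˡ (ιR-+ m n)) (sym (+-assoc _ _ _))

  ιR-* : ∀ m n → ιR R (m ℕ.* n) ≈ ιR R m * ιR R n
  ιR-* zero    n = sym (zeroˡ _)
  ιR-* (suc m) n = begin
    ιR R (n ℕ.+ m ℕ.* n)                ≈⟨ ιR-+ n (m ℕ.* n) ⟩
    ιR R n + ιR R (m ℕ.* n)             ≈⟨ +-cong (sym (*-identityˡ _)) (ιR-* m n) ⟩
    1# * ιR R n + ιR R m * ιR R n       ≈⟨ distribʳ _ _ _ ⟨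
    (1# + ιR R m) * ιR R n              ∎

  ⟦_⟧ℤ : ℤ → Carrier
  ⟦ + n      ⟧ℤ = ιR R n
  ⟦ -[1+ n ] ⟧ℤ = - ιR R (suc n)

  private
    1+-cancel-− : ∀ u v → (1# + u) - (1# + v) ≈ u - v
    1+-cancel-− u v = begin
      (1# + u) - (1# + v)       ≈⟨ +-congˡ (⁻¹-∙-comm 1# v) ⟨
      (1# + u) + (- 1# - v)     ≈⟨ +-assoc _ _ _ ⟩
      1# + (u + (- 1# - v))     ≈⟨ +-congˡ (+-assoc _ _ _) ⟨
      1# + ((u - 1#) - v)       ≈⟨ +-congˡ (+-congʳ (+-comm _ _)) ⟩
      1# + ((- 1# + u) - v)     ≈⟨ +-congˡ (+-assoc _ _ _) ⟩
      1# + (- 1# + (u - v))     ≈⟨ +-assoc _ _ _ ⟨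
      (1# - 1#) + (u - v)       ≈⟨ +-congʳ (-‿inverseʳ 1#) ⟩
      0# + (u - v)              ≈⟨ +-identityˡ _ ⟩
      u - v                     ∎

    ⊖-homo : ∀ m n → ⟦ m ⊖ n ⟧ℤ ≈ ιR R m - ιR R n
    ⊖-homo zero    zero    = sym (-‿inverseʳ 0#)
    ⊖-homo (suc m) zero    = sym (trans (+-congˡ ε⁻¹≈ε) (+-identityʳ _))
    ⊖-homo zero    (suc n) = sym (+-identityˡ _)
    ⊖-homo (suc m) (suc n) = begin
      ⟦ suc m ⊖ suc n ⟧ℤ        ≡⟨ P.cong ⟦_⟧ℤ (ℤP.[1+m]⊖[1+n]≡m⊖n m n) ⟩
      ⟦ m ⊖ n ⟧ℤ                ≈⟨ ⊖-homo m n ⟩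
      ιR R m - ιR R n           ≈⟨ 1+-cancel-− _ _ ⟨
      ιR R (suc m) - ιR R (suc n) ∎

    +-homo : ∀ i j → ⟦ i ℤ.+ j ⟧ℤ ≈ ⟦ i ⟧ℤ + ⟦ j ⟧ℤ
    +-homo -[1+ m ] -[1+ n ] = begin
      - ιR R (suc (suc (m ℕ.+ n)))  ≡⟨ P.cong (λ k → - ιR R (suc k)) (ℕP.+-suc m n) ⟨
      - ιR R (suc m ℕ.+ suc n)      ≈⟨ -‿cong (ιR-+ (suc m) (suc n)) ⟩
      - (ιR R (suc m) + ιR R (suc n)) ≈⟨ ⁻¹-∙-comm _ _ ⟨
      - ιR R (suc m) - ιR R (suc n) ∎
    +-homo -[1+ m ] (+ n)    = trans (⊖-homo n (suc m)) (+-comm _ _)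
    +-homo (+ m)    -[1+ n ] = ⊖-homo m (suc n)
    +-homo (+ m)    (+ n)    = ιR-+ m n

    -‿homo : ∀ i → ⟦ ℤ.- i ⟧ℤ ≈ - ⟦ i ⟧ℤ
    -‿homo -[1+ n ]  = sym (⁻¹-involutive _)
    -‿homo (+ zero)  = sym ε⁻¹≈ε
    -‿homo (+ suc n) = refl

    ◃+-homo : ∀ n → ⟦ Sign.+ ◃ n ⟧ℤ ≈ ιR R n
    ◃+-homo zero    = refl
    ◃+-homo (suc n) = refl

    ◃−-homo : ∀ n → ⟦ Sign.- ◃ n ⟧ℤ ≈ - ιR R n
    ◃−-homo zero    = sym ε⁻¹≈ε
    ◃−-homo (suc n) = refl

    *-homo : ∀ i j → ⟦ i ℤ.* j ⟧ℤ ≈ ⟦ i ⟧ℤ * ⟦ j ⟧ℤ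
    *-homo (+ m)    (+ n)    = trans (◃+-homo (m ℕ.* n)) (ιR-* m n)
    *-homo (+ m)    -[1+ n ] = trans (◃−-homo (m ℕ.* suc n))
      (trans (-‿cong (ιR-* m (suc n))) (-‿distribʳ-* _ _))
    *-homo -[1+ m ] (+ n)    = trans (◃−-homo (suc m ℕ.* n))
      (trans (-‿cong (ιR-* (suc m) n)) (-‿distribˡ-* _ _))
    *-homo -[1+ m ] -[1+ n ] = begin
      ⟦ Sign.+ ◃ (suc m ℕ.* suc n) ⟧ℤ   ≈⟨ ◃+-homo (suc m ℕ.* suc n) ⟩
      ιR R (suc m ℕ.* suc n)           ≈⟨ ιR-* (suc m) (suc n) ⟩
      ιR R (suc m) * ιR R (suc n)      ≈⟨ ⁻¹-involutive _ ⟨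
      - - (ιR R (suc m) * ιR R (suc n)) ≈⟨ -‿cong (-‿distribˡ-* _ _) ⟩
      - (- ιR R (suc m) * ιR R (suc n)) ≈⟨ -‿distribʳ-* _ _ ⟩
      - ιR R (suc m) * - ιR R (suc n)  ∎

    isZero : ℤ → Bool
    isZero (+ zero) = true
    isZero _        = false

    isZero-sound : ∀ i → T (isZero i) → 0# ≈ ⟦ i ⟧ℤ
    isZero-sound (+ zero) _ = refl

    homomorphism : Homomorphism _ _ c ℓ
    homomorphism = record
      { from = record { rawRing = ℤ.+-*-rawRing ; isZero = isZero }
      ; to = fromCommutativeRing R (λ _ → nothing)
      ; morphism = record
        { ⟦_⟧ = ⟦_⟧ℤ ; +-homo = +-homo ; *-homo = *-homo ; -‿homo = -‿homo
        ; 0-homo = refl ; 1-homo = +-identityʳ 1# }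
      ; Zero-C⟶Zero-R = isZero-sound
      }

  open import Tactic.RingSolver.Core.Expression public using (Expr; Κ; Ι; _⊕_; _⊗_; _⊛_; ⊝_)
  open import Tactic.RingSolver.Core.Expression using (module Eval)
  open Eval rawRing ⟦_⟧ℤ using (⟦_⟧)

  private
    open import Tactic.RingSolver.Core.Polynomial.Base (Homomorphism.from homomorphism)

    normalise : ∀ {n} → Expr ℤ n → Poly n
    normalise (Κ x)   = κ x
    normalise (Ι x)   = ι x
    normalise (x ⊕ y) = normalise x ⊞ normalise y
    normalise (x ⊗ y) = normalise x ⊠ normalise y
    normalise (⊝ x)   = ⊟ normalise x
    normalise (x ⊛ i) = normalise x ⊡ i

    ⟦_⇓⟧ : ∀ {n} → Expr ℤ n → Vec Carrier n → Carrier
    ⟦ e ⇓⟧ = ⟦ normalise e ⟧ₚ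
      where open import Tactic.RingSolver.Core.Polynomial.Semantics homomorphism renaming (⟦_⟧ to ⟦_⟧ₚ)

    correct : ∀ {n} (e : Expr ℤ n) ρ → ⟦ e ⇓⟧ ρ ≈ ⟦ e ⟧ ρ
    correct {n} = go
      where
      open import Tactic.RingSolver.Core.Polynomial.Homomorphism homomorphism
      open import Algebra.Properties.Semiring.Exp.TCOptimised semiring using (^-congˡ)

      go : ∀ (e : Expr ℤ n) ρ → ⟦ e ⇓⟧ ρ ≈ ⟦ e ⟧ ρ
      go (Κ x)   ρ = κ-hom x ρ
      go (Ι x)   ρ = ι-hom x ρ
      go (x ⊕ y) ρ = trans (⊞-hom (normalise x) (normalise y) ρ) (+-cong (go x ρ) (go y ρ))
      go (x ⊗ y) ρ = trans (⊠-hom (normalise x) (normalise y) ρ) (*-cong (go x ρ) (go y ρ))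
      go (⊝ x)   ρ = trans (⊟-hom (normalise x) ρ) (-‿cong (go x ρ))
      go (x ⊛ i) ρ = trans (⊡-hom (normalise x) i ρ) (^-congˡ i (go x ρ))

  open import Relation.Binary.Reflection setoid Ι ⟦_⟧ ⟦_⇓⟧ correct public using (solve)

  infix 4 _⊜_
  _⊜_ : ∀ {n} → Expr ℤ n → Expr ℤ n → Expr ℤ n × Expr ℤ n
  _⊜_ = _,_

  -- 𝟏 evaluates to 1# (whereas Κ (+ 1) evaluates to 1# + 0#), and m ⊕ℕ e to ι (m + n)
  -- whenever e evaluates to ι n.
  𝟏 : ∀ {n} → Expr ℤ n
  𝟏 = Κ (+ 0) ⊛ 0

  infixr 6 _⊕ℕ_
  _⊕ℕ_ : ∀ {n} → ℕ → Expr ℤ n → Expr ℤ n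
  zero  ⊕ℕ e = e
  suc m ⊕ℕ e = 𝟏 ⊕ (m ⊕ℕ e)

module _ where
  open import Data.Nat using (_+_; _*_)
  open ℕP using (*-zeroʳ; *-identityˡ; *-identityʳ; +-identityʳ)
  open P using (_≡_; refl; sym; trans; cong; cong₂)
  open P.≡-Reasoning
  open +-*-Solver using (solve; _:=_; _:+_; _:*_; con)

  absorption : ∀ n j → suc j * (suc n C suc j) ≡ suc n * (n C j)
  absorption zero    zero    = refl
  absorption zero    (suc j) = begin
    suc (suc j) * (1 C suc (suc j))
      ≡⟨ cong (suc (suc j) *_) (k>n⇒nCk≡0 {1} {suc (suc j)} (s≤s (s≤s z≤n))) ⟩
    suc (suc j) * 0
      ≡⟨ *-zeroʳ (suc (suc j)) ⟩
    0
      ≡⟨ cong (1 *_) (k>n⇒nCk≡0 {0} {suc j} (s≤s z≤n)) ⟨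
    1 * (0 C suc j) ∎
  absorption (suc n) zero    = trans (*-identityˡ _) (trans (nC1≡n (suc (suc n))) (sym (*-identityʳ _)))
  absorption (suc n) (suc j) = begin
    suc (suc j) * (suc (suc n) C suc (suc j))
      ≡⟨ cong (suc (suc j) *_) (nCk+nC[k+1]≡[n+1]C[k+1] (suc n) (suc j)) ⟨
    suc (suc j) * (A + B)
      ≡⟨ solve 3 (λ j A B → (con 2 :+ j) :* (A :+ B) := (con 1 :+ j) :* A :+ A :+ (con 2 :+ j) :* B)
               refl j A B ⟩
    suc j * A + A + suc (suc j) * B
      ≡⟨ cong₂ _+_ (cong₂ _+_ (absorption n j) (sym (nCk+nC[k+1]≡[n+1]C[k+1] n j)))
                   (absorption n (suc j)) ⟩
    suc n * (n C j) + (n C j + n C suc j) + suc n * (n C suc j)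
      ≡⟨ solve 3 (λ n P Q → (con 1 :+ n) :* P :+ (P :+ Q) :+ (con 1 :+ n) :* Q := (con 2 :+ n) :* (P :+ Q))
               refl n (n C j) (n C suc j) ⟩
    suc (suc n) * (n C j + n C suc j)
      ≡⟨ cong (suc (suc n) *_) (nCk+nC[k+1]≡[n+1]C[k+1] n j) ⟩
    suc (suc n) * (suc n C suc j) ∎
    where
    A B : ℕ
    A = suc n C suc j
    B = suc n C suc (suc j)

  weighted-pascal : ∀ n k → suc n * (n C k) + k * (suc n C k) ≡ suc n * (suc n C k)
  weighted-pascal n zero    = +-identityʳ _
  weighted-pascal n (suc j) = begin
    suc n * (n C suc j) + suc j * (suc n C suc j)
      ≡⟨ cong (λ m → suc n * (n C suc j) + m) (absorption n j) ⟩
    suc n * (n C suc j) + suc n * (n C j)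
      ≡⟨ solve 3 (λ n P Q → (con 1 :+ n) :* Q :+ (con 1 :+ n) :* P := (con 1 :+ n) :* (P :+ Q))
               refl n (n C j) (n C suc j) ⟩
    suc n * (n C j + n C suc j)
      ≡⟨ cong (suc n *_) (nCk+nC[k+1]≡[n+1]C[k+1] n j) ⟩
    suc n * (suc n C suc j) ∎

module FieldLemmas {c ℓ} (F : CharZeroField c ℓ) where
  open CharZeroField F
  open FieldOps F
  open IntegerCoefficientSolver commutativeRing
    using (solve; _⊜_; Κ; _⊕_; _⊗_; ⊝_; 𝟏; _⊕ℕ_; ιR-+; ιR-*)
  open import Relation.Binary.Reasoning.Setoid setoid

  ι-+ : ∀ m n → ι (m ℕ.+ n) ≈ ι m + ι n
  ι-+ = ιR-+

  ι-* : ∀ m n → ι (m ℕ.* n) ≈ ι m * ι n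
  ι-* = ιR-*

  ι-≡ : ∀ {m n} → m P.≡ n → ι m ≈ ι n
  ι-≡ m≡n = reflexive (P.cong ι m≡n)

  +ι-+ : ∀ s m n → s + ι (m ℕ.+ n) ≈ s + ι m + ι n
  +ι-+ s m n = trans (+-congˡ (ι-+ m n)) (sym (+-assoc _ _ _))

  +ι-suc-swap : ∀ s i j → s + ι (suc i) + ι j ≈ s + ι i + ι (suc j)
  +ι-suc-swap s i j = solve 3 (λ s I J → s ⊕ (𝟏 ⊕ I) ⊕ J ⊜ s ⊕ I ⊕ (𝟏 ⊕ J)) refl s (ι i) (ι j)

  *-nonzero : ∀ {u v} → ¬ u ≈ 0# → ¬ v ≈ 0# → ¬ u * v ≈ 0#
  *-nonzero {u} {v} u≉0 v≉0 uv≈0 = u≉0 (begin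
    u                 ≈⟨ *-identityʳ u ⟨
    u * 1#            ≈⟨ *-congˡ (inverseʳ v v≉0) ⟨
    u * (v * v ⁻¹)    ≈⟨ *-assoc _ _ _ ⟨
    (u * v) * v ⁻¹    ≈⟨ *-congʳ uv≈0 ⟩
    0# * v ⁻¹         ≈⟨ zeroˡ _ ⟩
    0#                ∎)

  *-cancelˡ : ∀ {w u v} → ¬ w ≈ 0# → w * u ≈ w * v → u ≈ v
  *-cancelˡ {w} {u} {v} w≉0 eq = begin
    u                  ≈⟨ *-identityˡ u ⟨
    1# * u             ≈⟨ *-congʳ (inverseʳ w w≉0) ⟨
    (w * w ⁻¹) * u     ≈⟨ solve 3 (λ w i u → (w ⊗ i) ⊗ u ⊜ i ⊗ (w ⊗ u)) refl w (w ⁻¹) u ⟩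
    w ⁻¹ * (w * u)     ≈⟨ *-congˡ eq ⟩
    w ⁻¹ * (w * v)     ≈⟨ solve 3 (λ w i v → i ⊗ (w ⊗ v) ⊜ (w ⊗ i) ⊗ v) refl w (w ⁻¹) v ⟩
    (w * w ⁻¹) * v     ≈⟨ *-congʳ (inverseʳ w w≉0) ⟩
    1# * v             ≈⟨ *-identityˡ v ⟩
    v                  ∎

  ⁻¹-unique : ∀ {w u} → ¬ w ≈ 0# → w * u ≈ 1# → u ≈ w ⁻¹
  ⁻¹-unique {w} w≉0 wu≈1 = *-cancelˡ w≉0 (trans wu≈1 (sym (inverseʳ w w≉0)))

  ⁻¹-nonzero : ∀ {u} → ¬ u ≈ 0# → ¬ u ⁻¹ ≈ 0#
  ⁻¹-nonzero {u} u≉0 u⁻¹≈0 = charZero 0 (begin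
    1# + 0#      ≈⟨ +-identityʳ 1# ⟩
    1#           ≈⟨ inverseʳ u u≉0 ⟨
    u * u ⁻¹     ≈⟨ *-congˡ u⁻¹≈0 ⟩
    u * 0#       ≈⟨ zeroʳ u ⟩
    0#           ∎)

  ⁻¹-of-factor : ∀ {u v} → ¬ u * v ≈ 0# → u ⁻¹ ≈ (u * v) ⁻¹ * v
  ⁻¹-of-factor {u} {v} uv≉0 = sym (⁻¹-unique u≉0 (begin
    u * ((u * v) ⁻¹ * v)    ≈⟨ solve 3 (λ u v i → u ⊗ (i ⊗ v) ⊜ (u ⊗ v) ⊗ i) refl u v ((u * v) ⁻¹) ⟩
    (u * v) * (u * v) ⁻¹    ≈⟨ inverseʳ _ uv≉0 ⟩
    1#                      ∎))
    where
    u≉0 : ¬ u ≈ 0#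
    u≉0 u≈0 = uv≉0 (trans (*-congʳ u≈0) (zeroˡ v))

  *-inverse-cancelˡ : ∀ {w} u → ¬ w ≈ 0# → w * (w ⁻¹ * u) ≈ u
  *-inverse-cancelˡ {w} u w≉0 = begin
    w * (w ⁻¹ * u)    ≈⟨ *-assoc _ _ _ ⟨
    (w * w ⁻¹) * u    ≈⟨ *-congʳ (inverseʳ w w≉0) ⟩
    1# * u            ≈⟨ *-identityˡ u ⟩
    u                 ∎

  −≈0⇒≈ : ∀ {u v} → u - v ≈ 0# → u ≈ v
  −≈0⇒≈ {u} {v} u−v≈0 = begin
    u               ≈⟨ solve 2 (λ u v → u ⊜ (u ⊕ ⊝ v) ⊕ v) refl u v ⟩
    (u - v) + v     ≈⟨ +-congʳ u−v≈0 ⟩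
    0# + v          ≈⟨ +-identityˡ v ⟩
    v               ∎

  −≈-⇒≈− : ∀ {u v w} → u - v ≈ - w → u ≈ v - w
  −≈-⇒≈− {u} {v} {w} u−v≈-w = begin
    u               ≈⟨ solve 2 (λ u v → u ⊜ (u ⊕ ⊝ v) ⊕ v) refl u v ⟩
    (u - v) + v     ≈⟨ +-congʳ u−v≈-w ⟩
    - w + v         ≈⟨ +-comm _ _ ⟩
    v - w           ∎

  1⁻¹≈1 : 1# ⁻¹ ≈ 1#
  1⁻¹≈1 = sym (⁻¹-unique (λ 1≈0 → charZero 0 (trans (+-identityʳ 1#) 1≈0)) (*-identityˡ 1#))

  ι-nonzero : ∀ {n} → 1 ≤ n → ¬ ι n ≈ 0#
  ι-nonzero {suc n} _ = charZero n

  ratio-cancel : ∀ {B₁ B₂ B₃ B₄ u₁ u₂ v₁ v₂ f} →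
    B₁ ≈ u₁ * f → B₂ ≈ u₂ * f → B₃ ≈ v₁ * f → B₄ ≈ v₂ * f →
    ¬ f ≈ 0# → ¬ v₁ ≈ 0# → ¬ v₂ ≈ 0# →
    (B₁ * B₂) ÷ (B₃ * B₄) ≈ u₁ * u₂ * (v₁ ⁻¹ * v₂ ⁻¹)
  ratio-cancel {B₁} {B₂} {B₃} {B₄} {u₁} {u₂} {v₁} {v₂} {f} B₁≈ B₂≈ B₃≈ B₄≈ f≉0 v₁≉0 v₂≉0 =
    *-cancelˡ Z≉0 (begin
      Z * ((B₁ * B₂) * Z ⁻¹)
        ≈⟨ solve 3 (λ Z B i → Z ⊗ (B ⊗ i) ⊜ B ⊗ (Z ⊗ i)) refl Z (B₁ * B₂) (Z ⁻¹) ⟩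
      (B₁ * B₂) * (Z * Z ⁻¹)
        ≈⟨ *-cong (*-cong B₁≈ B₂≈) (inverseʳ Z Z≉0) ⟩
      (u₁ * f) * (u₂ * f) * 1#
        ≈⟨ *-congˡ (trans (*-cong (inverseʳ v₁ v₁≉0) (inverseʳ v₂ v₂≉0)) (*-identityˡ 1#)) ⟨
      (u₁ * f) * (u₂ * f) * ((v₁ * v₁ ⁻¹) * (v₂ * v₂ ⁻¹))
        ≈⟨ solve 7 (λ u₁ u₂ v₁ v₂ f i₁ i₂ →
             (u₁ ⊗ f) ⊗ (u₂ ⊗ f) ⊗ ((v₁ ⊗ i₁) ⊗ (v₂ ⊗ i₂))
               ⊜ ((v₁ ⊗ f) ⊗ (v₂ ⊗ f)) ⊗ (u₁ ⊗ u₂ ⊗ (i₁ ⊗ i₂)))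
           refl u₁ u₂ v₁ v₂ f (v₁ ⁻¹) (v₂ ⁻¹) ⟩
      ((v₁ * f) * (v₂ * f)) * (u₁ * u₂ * (v₁ ⁻¹ * v₂ ⁻¹))
        ≈⟨ *-congʳ (*-cong B₃≈ B₄≈) ⟨
      Z * (u₁ * u₂ * (v₁ ⁻¹ * v₂ ⁻¹)) ∎)
    where
    Z : Carrier
    Z = B₃ * B₄
    Z≉0 : ¬ Z ≈ 0#
    Z≉0 Z≈0 = *-nonzero (*-nonzero v₁≉0 f≉0) (*-nonzero v₂≉0 f≉0)
                        (trans (sym (*-cong B₃≈ B₄≈)) Z≈0)

  sgn≈-sgn-suc : ∀ k → sgn k ≈ - sgn (suc k)
  sgn≈-sgn-suc k = sym (⁻¹-involutive (sgn k))
    where open import Algebra.Properties.Group +-group using (⁻¹-involutive)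

  -- Finite sums

  sum0to-cong : ∀ n {f g : ℕ → Carrier} → (∀ k → k ≤ n → f k ≈ g k) → sum0to n f ≈ sum0to n g
  sum0to-cong zero    f≈g = f≈g 0 z≤n
  sum0to-cong (suc n) f≈g =
    +-cong (sum0to-cong n (λ k k≤n → f≈g k (ℕP.m≤n⇒m≤1+n k≤n))) (f≈g (suc n) ℕP.≤-refl)

  sum0to-*ˡ : ∀ n w (f : ℕ → Carrier) → sum0to n (λ k → w * f k) ≈ w * sum0to n f
  sum0to-*ˡ zero    w f = refl
  sum0to-*ˡ (suc n) w f = trans (+-congʳ (sum0to-*ˡ n w f)) (sym (distribˡ _ _ _))

  sum0to-linear : ∀ n p q (f g : ℕ → Carrier) →
                  sum0to n (λ k → p * f k - q * g k) ≈ p * sum0to n f - q * sum0to n g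
  sum0to-linear zero    p q f g = refl
  sum0to-linear (suc n) p q f g = trans (+-congʳ (sum0to-linear n p q f g))
    (solve 6 (λ p q F G f g → p ⊗ F ⊕ ⊝ (q ⊗ G) ⊕ (p ⊗ f ⊕ ⊝ (q ⊗ g))
                                ⊜ p ⊗ (F ⊕ f) ⊕ ⊝ (q ⊗ (G ⊕ g)))
      refl p q (sum0to n f) (sum0to n g) (f (suc n)) (g (suc n)))

  sum0to-telescope : ∀ n (g : ℕ → Carrier) → sum0to n (λ k → g (suc k) - g k) ≈ g (suc n) - g 0
  sum0to-telescope zero    g = refl
  sum0to-telescope (suc n) g = trans (+-congʳ (sum0to-telescope n g))
    (solve 3 (λ g₂ g₁ g₀ → g₁ ⊕ ⊝ g₀ ⊕ (g₂ ⊕ ⊝ g₁) ⊜ g₂ ⊕ ⊝ g₀)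
       refl (g (suc (suc n))) (g (suc n)) (g 0))

  sum0to-by-parts : ∀ n (g h : ℕ → Carrier) →
    sum0to (suc n) (λ k → (g (suc k) - g k) * h k)
      ≈ g (suc (suc n)) * h (suc n) - g 0 * h 0 - sum0to n (λ k → g (suc k) * (h (suc k) - h k))
  sum0to-by-parts zero g h = solve 5 (λ g₀ g₁ g₂ h₀ h₁ →
      (g₁ ⊕ ⊝ g₀) ⊗ h₀ ⊕ (g₂ ⊕ ⊝ g₁) ⊗ h₁ ⊜ g₂ ⊗ h₁ ⊕ ⊝ (g₀ ⊗ h₀) ⊕ ⊝ (g₁ ⊗ (h₁ ⊕ ⊝ h₀)))
    refl (g 0) (g 1) (g 2) (h 0) (h 1)
  sum0to-by-parts (suc n) g h = trans (+-congʳ (sum0to-by-parts n g h))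
    (solve 7 (λ g₀ h₀ g₂ g₃ h₁ h₂ S →
        g₂ ⊗ h₁ ⊕ ⊝ (g₀ ⊗ h₀) ⊕ ⊝ S ⊕ (g₃ ⊕ ⊝ g₂) ⊗ h₂
          ⊜ g₃ ⊗ h₂ ⊕ ⊝ (g₀ ⊗ h₀) ⊕ ⊝ (S ⊕ g₂ ⊗ (h₂ ⊕ ⊝ h₁)))
      refl (g 0) (h 0) (g (suc (suc n))) (g (suc (suc (suc n)))) (h (suc n)) (h (suc (suc n)))
      (sum0to n (λ k → g (suc k) * (h (suc k) - h k))))

  sum0to-recurrence : ∀ n p q (F₁ F₀ D : ℕ → Carrier) → F₀ (suc n) ≈ 0# →
    (∀ k → k ≤ suc n → p * F₁ k - q * F₀ k ≈ D k) →
    p * sum0to (suc n) F₁ - q * sum0to n F₀ ≈ sum0to (suc n) D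
  sum0to-recurrence n p q F₁ F₀ D F₀-top≈0 certificate = begin
    p * sum0to (suc n) F₁ - q * sum0to n F₀
      ≈⟨ +-congˡ (-‿cong (*-congˡ (trans (+-congˡ F₀-top≈0) (+-identityʳ _)))) ⟨
    p * sum0to (suc n) F₁ - q * sum0to (suc n) F₀
      ≈⟨ sum0to-linear (suc n) p q F₁ F₀ ⟨
    sum0to (suc n) (λ k → p * F₁ k - q * F₀ k)
      ≈⟨ sum0to-cong (suc n) certificate ⟩
    sum0to (suc n) D ∎

  -- Rising products

  rising : Carrier → ℕ → ℕ → Carrier
  rising s i zero    = 1#
  rising s i (suc m) = (s + ι i) * rising s (suc i) m

  risingAbove : Carrier → ℕ → Carrier
  risingAbove z zero    = 1#
  risingAbove z (suc k) = risingAbove z k * (z + ι (suc k))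

  rising-snoc : ∀ s i m → rising s i (suc m) ≈ rising s i m * (s + ι (i ℕ.+ m))
  rising-snoc s i zero = begin
    (s + ι i) * 1#            ≈⟨ *-comm _ _ ⟩
    1# * (s + ι i)            ≡⟨ P.cong (λ j → 1# * (s + ι j)) (ℕP.+-identityʳ i) ⟨
    1# * (s + ι (i ℕ.+ 0))    ∎
  rising-snoc s i (suc m) = begin
    (s + ι i) * rising s (suc i) (suc m)
      ≈⟨ *-congˡ (rising-snoc s (suc i) m) ⟩
    (s + ι i) * (rising s (suc i) m * (s + ι (suc i ℕ.+ m)))
      ≈⟨ *-assoc _ _ _ ⟨
    (s + ι i) * rising s (suc i) m * (s + ι (suc i ℕ.+ m))
      ≡⟨ P.cong (λ j → rising s i (suc m) * (s + ι j)) (ℕP.+-suc i m) ⟨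
    rising s i (suc m) * (s + ι (i ℕ.+ suc m)) ∎

  rising-++ : ∀ s i m m′ → rising s i (m ℕ.+ m′) ≈ rising s i m * rising s (i ℕ.+ m) m′
  rising-++ s i zero m′ = begin
    rising s i m′                  ≡⟨ P.cong (λ j → rising s j m′) (ℕP.+-identityʳ i) ⟨
    rising s (i ℕ.+ 0) m′          ≈⟨ *-identityˡ _ ⟨
    1# * rising s (i ℕ.+ 0) m′     ∎
  rising-++ s i (suc m) m′ = begin
    (s + ι i) * rising s (suc i) (m ℕ.+ m′)
      ≈⟨ *-congˡ (rising-++ s (suc i) m m′) ⟩
    (s + ι i) * (rising s (suc i) m * rising s (suc i ℕ.+ m) m′)
      ≈⟨ *-assoc _ _ _ ⟨
    rising s i (suc m) * rising s (suc i ℕ.+ m) m′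
      ≡⟨ P.cong (λ j → rising s i (suc m) * rising s j m′) (ℕP.+-suc i m) ⟨
    rising s i (suc m) * rising s (i ℕ.+ suc m) m′ ∎

  rising-+ι : ∀ s i j m → rising (s + ι i) j m ≈ rising s (i ℕ.+ j) m
  rising-+ι s i j zero    = refl
  rising-+ι s i j (suc m) = *-cong (sym (+ι-+ s i j)) (begin
    rising (s + ι i) (suc j) m    ≈⟨ rising-+ι s i (suc j) m ⟩
    rising s (i ℕ.+ suc j) m      ≡⟨ P.cong (λ l → rising s l m) (ℕP.+-suc i j) ⟩
    rising s (suc (i ℕ.+ j)) m    ∎)

  rising-nonzero : ∀ s i m → (∀ j → j < m → ¬ s + ι (i ℕ.+ j) ≈ 0#) → ¬ rising s i m ≈ 0#
  rising-nonzero s i zero    _       1≈0 = charZero 0 (trans (+-identityʳ 1#) 1≈0)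
  rising-nonzero s i (suc m) factors≉0 ≈0 =
    *-nonzero (rising-nonzero s i m (λ j j<m → factors≉0 j (ℕP.m<n⇒m<1+n j<m)))
              (factors≉0 m ℕP.≤-refl)
              (trans (sym (rising-snoc s i m)) ≈0)

  risingAbove≈rising : ∀ z k → risingAbove z k ≈ rising z 1 k
  risingAbove≈rising z zero    = refl
  risingAbove≈rising z (suc k) =
    trans (*-congʳ (risingAbove≈rising z k)) (sym (rising-snoc z 1 k))

  falling-suc : ∀ w t → falling (w + 1#) (suc t) ≈ (w + 1#) * falling w t
  falling-suc w zero = solve 1 (λ w → 𝟏 ⊗ (w ⊕ 𝟏 ⊕ ⊝ Κ (+ 0)) ⊜ (w ⊕ 𝟏) ⊗ 𝟏) refl w
  falling-suc w (suc t) = begin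
    falling (w + 1#) (suc t) * ((w + 1#) - ι (suc t))
      ≈⟨ *-congʳ (falling-suc w t) ⟩
    (w + 1#) * falling w t * ((w + 1#) - ι (suc t))
      ≈⟨ solve 3 (λ w f τ → (w ⊕ 𝟏) ⊗ f ⊗ ((w ⊕ 𝟏) ⊕ ⊝ (𝟏 ⊕ τ)) ⊜ (w ⊕ 𝟏) ⊗ (f ⊗ (w ⊕ ⊝ τ)))
           refl w (falling w t) (ι t) ⟩
    (w + 1#) * (falling w t * (w - ι t)) ∎

  falling≈risingAbove : ∀ z k → falling (z + ι k) k ≈ risingAbove z k
  falling≈risingAbove z zero    = refl
  falling≈risingAbove z (suc k) = begin
    falling (z + ι (suc k)) (suc k)
      ≈⟨ falling-cong (solve 2 (λ z κ → z ⊕ (𝟏 ⊕ κ) ⊜ z ⊕ κ ⊕ 𝟏) refl z (ι k)) (suc k) ⟩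
    falling (z + ι k + 1#) (suc k)          ≈⟨ falling-suc (z + ι k) k ⟩
    (z + ι k + 1#) * falling (z + ι k) k    ≈⟨ *-congˡ (falling≈risingAbove z k) ⟩
    (z + ι k + 1#) * risingAbove z k
      ≈⟨ solve 3 (λ z κ r → (z ⊕ κ ⊕ 𝟏) ⊗ r ⊜ r ⊗ (z ⊕ (𝟏 ⊕ κ))) refl z (ι k) (risingAbove z k) ⟩
    risingAbove z (suc k)                   ∎
    where
    falling-cong : ∀ {w w′} → w ≈ w′ → ∀ t → falling w t ≈ falling w′ t
    falling-cong w≈w′ zero    = refl
    falling-cong w≈w′ (suc t) = *-cong (falling-cong w≈w′ t) (+-congʳ w≈w′)

  binom≈risingAbove : ∀ z k → binom (z + ι k) k ≈ risingAbove z k * ι (k !) ⁻¹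
  binom≈risingAbove z k = *-congʳ (falling≈risingAbove z k)

  risingAbove-nonzero : ∀ z k → (∀ j → suc j ≤ k → ¬ z + ι (suc j) ≈ 0#) → ¬ risingAbove z k ≈ 0#
  risingAbove-nonzero z zero    _         1≈0 = charZero 0 (trans (+-identityʳ 1#) 1≈0)
  risingAbove-nonzero z (suc k) factors≉0 =
    *-nonzero (risingAbove-nonzero z k (λ j j<k → factors≉0 j (ℕP.m≤n⇒m≤1+n j<k)))
              (factors≉0 k ℕP.≤-refl)

  binom≉0⇒risingAbove≉0 : ∀ z k → ¬ binom (z + ι k) k ≈ 0# → ¬ risingAbove z k ≈ 0#
  binom≉0⇒risingAbove≉0 z k binom≉0 ≈0 =
    binom≉0 (trans (binom≈risingAbove z k) (trans (*-congʳ ≈0) (zeroˡ _)))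

  rising-∸-snoc : ∀ s i {k n} → k ≤ n →
    rising s (i ℕ.+ k) (suc n ∸ k) ≈ rising s (i ℕ.+ k) (n ∸ k) * (s + ι i + ι n)
  rising-∸-snoc s i {k} {n} k≤n = begin
    rising s (i ℕ.+ k) (suc n ∸ k)
      ≡⟨ P.cong (rising s (i ℕ.+ k)) (ℕP.+-∸-assoc 1 k≤n) ⟩
    rising s (i ℕ.+ k) (suc (n ∸ k))
      ≈⟨ rising-snoc s (i ℕ.+ k) (n ∸ k) ⟩
    rising s (i ℕ.+ k) (n ∸ k) * (s + ι (i ℕ.+ k ℕ.+ (n ∸ k)))
      ≡⟨ P.cong (λ j → rising s (i ℕ.+ k) (n ∸ k) * (s + ι j)) (far-end-index i k≤n) ⟩
    rising s (i ℕ.+ k) (n ∸ k) * (s + ι (i ℕ.+ n))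
      ≈⟨ *-congˡ (+ι-+ s i n) ⟩
    rising s (i ℕ.+ k) (n ∸ k) * (s + ι i + ι n) ∎
    where
    far-end-index : ∀ i {k n} → k ≤ n → i ℕ.+ k ℕ.+ (n ∸ k) P.≡ i ℕ.+ n
    far-end-index i {k} k≤n = P.trans (ℕP.+-assoc i k _) (P.cong (i ℕ.+_) (ℕP.m+[n∸m]≡n k≤n))

  rising-∸-shift : ∀ s i {k n} → k ≤ n →
    (s + ι i + ι n) * rising s (i ℕ.+ k) (n ∸ k) ≈ (s + ι i + ι k) * rising s (suc i ℕ.+ k) (n ∸ k)
  rising-∸-shift s i {k} {n} k≤n = begin
    (s + ι i + ι n) * rising s (i ℕ.+ k) (n ∸ k)
      ≈⟨ *-comm _ _ ⟩
    rising s (i ℕ.+ k) (n ∸ k) * (s + ι i + ι n)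
      ≈⟨ rising-∸-snoc s i k≤n ⟨
    rising s (i ℕ.+ k) (suc n ∸ k)
      ≡⟨ P.cong (rising s (i ℕ.+ k)) (ℕP.+-∸-assoc 1 k≤n) ⟩
    (s + ι (i ℕ.+ k)) * rising s (suc i ℕ.+ k) (n ∸ k)
      ≈⟨ *-congʳ (+ι-+ s i k) ⟩
    (s + ι i + ι k) * rising s (suc i ℕ.+ k) (n ∸ k) ∎

  rising-∸-uncons : ∀ s i {j n} → suc j ≤ n →
    rising s (i ℕ.+ j) (n ∸ j) ≈ (s + ι i + ι j) * rising s (i ℕ.+ suc j) (n ∸ suc j)
  rising-∸-uncons s i {j} {suc n} (s≤s j≤n) = begin
    rising s (i ℕ.+ j) (suc n ∸ j)
      ≡⟨ P.cong (rising s (i ℕ.+ j)) (ℕP.+-∸-assoc 1 j≤n) ⟩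
    (s + ι (i ℕ.+ j)) * rising s (suc (i ℕ.+ j)) (n ∸ j)
      ≡⟨ P.cong (λ l → (s + ι (i ℕ.+ j)) * rising s l (n ∸ j)) (ℕP.+-suc i j) ⟨
    (s + ι (i ℕ.+ j)) * rising s (i ℕ.+ suc j) (n ∸ j)
      ≈⟨ *-congʳ (+ι-+ s i j) ⟩
    (s + ι i + ι j) * rising s (i ℕ.+ suc j) (n ∸ j) ∎

  -- Binomial coefficients

  choose-diag : ∀ n → choose n n ≈ 1#
  choose-diag n = trans (ι-≡ (nCn≡1 n)) (+-identityʳ 1#)

  choose-top : ∀ n → choose n (suc n) ≈ 0#
  choose-top n = ι-≡ (k>n⇒nCk≡0 {n} ℕP.≤-refl)

  -- C(n,k), C(n+1,k) and C(n,k−1) are (n+1−k)·u, (n+1)·u and k·u for u = C(n+1,k)/(n+1);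
  -- this turns the telescoping certificates below into polynomial identities.
  chooseUnit : ℕ → ℕ → Carrier
  chooseUnit n k = choose (suc n) k * ι (suc n) ⁻¹

  choose-suc≈ : ∀ n k → choose (suc n) k ≈ ι (suc n) * chooseUnit n k
  choose-suc≈ n k = begin
    choose (suc n) k                               ≈⟨ *-identityʳ _ ⟨
    choose (suc n) k * 1#                          ≈⟨ *-congˡ (inverseʳ _ (charZero n)) ⟨
    choose (suc n) k * (ι (suc n) * ι (suc n) ⁻¹)
      ≈⟨ solve 3 (λ C ν i → C ⊗ (ν ⊗ i) ⊜ ν ⊗ (C ⊗ i))
           refl (choose (suc n) k) (ι (suc n)) (ι (suc n) ⁻¹) ⟩
    ι (suc n) * chooseUnit n k                     ∎

  choose≈ : ∀ n k → choose n k ≈ (ι (suc n) - ι k) * chooseUnit n k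
  choose≈ n k = *-cancelˡ (charZero n) (begin
    ν * choose n k
      ≈⟨ solve 3 (λ X κ C → X ⊜ X ⊕ κ ⊗ C ⊕ ⊝ (κ ⊗ C)) refl (ν * choose n k) (ι k) (choose (suc n) k) ⟩
    ν * choose n k + ι k * choose (suc n) k - ι k * choose (suc n) k
      ≈⟨ +-congʳ weighted-pascal′ ⟩
    ν * choose (suc n) k - ι k * choose (suc n) k
      ≈⟨ +-cong (*-congˡ (choose-suc≈ n k)) (-‿cong (*-congˡ (choose-suc≈ n k))) ⟩
    ν * (ν * chooseUnit n k) - ι k * (ν * chooseUnit n k)
      ≈⟨ solve 3 (λ ν κ u → ν ⊗ (ν ⊗ u) ⊕ ⊝ (κ ⊗ (ν ⊗ u)) ⊜ ν ⊗ ((ν ⊕ ⊝ κ) ⊗ u))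
           refl ν (ι k) (chooseUnit n k) ⟩
    ν * ((ν - ι k) * chooseUnit n k) ∎)
    where
    ν : Carrier
    ν = ι (suc n)
    weighted-pascal′ : ν * choose n k + ι k * choose (suc n) k ≈ ν * choose (suc n) k
    weighted-pascal′ = begin
      ν * choose n k + ι k * choose (suc n) k
        ≈⟨ +-cong (ι-* (suc n) (n C k)) (ι-* k (suc n C k)) ⟨
      ι (suc n ℕ.* (n C k)) + ι (k ℕ.* (suc n C k))
        ≈⟨ ι-+ (suc n ℕ.* (n C k)) _ ⟨
      ι (suc n ℕ.* (n C k) ℕ.+ k ℕ.* (suc n C k))
        ≈⟨ ι-≡ (weighted-pascal n k) ⟩
      ι (suc n ℕ.* (suc n C k))
        ≈⟨ ι-* (suc n) (suc n C k) ⟩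
      ν * choose (suc n) k ∎

  choose-pred≈ : ∀ n j → choose n j ≈ ι (suc j) * chooseUnit n (suc j)
  choose-pred≈ n j = *-cancelˡ (charZero n) (begin
    ι (suc n) * choose n j                    ≈⟨ ι-* (suc n) (n C j) ⟨
    ι (suc n ℕ.* (n C j))                     ≈⟨ ι-≡ (absorption n j) ⟨
    ι (suc j ℕ.* (suc n C suc j))             ≈⟨ ι-* (suc j) (suc n C suc j) ⟩
    ι (suc j) * choose (suc n) (suc j)        ≈⟨ *-congˡ (choose-suc≈ n (suc j)) ⟩
    ι (suc j) * (ι (suc n) * chooseUnit n (suc j))
      ≈⟨ solve 3 (λ κ ν u → κ ⊗ (ν ⊗ u) ⊜ ν ⊗ (κ ⊗ u))
           refl (ι (suc j)) (ι (suc n)) (chooseUnit n (suc j)) ⟩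
    ι (suc n) * (ι (suc j) * chooseUnit n (suc j)) ∎)


  two : Carrier
  two = ι 2

  module Sums (x y : Carrier) where

    a b d e : Carrier
    a = two * x
    b = two * y
    d = a - b
    e = x - two * y - 1#

    -- The auxiliary sum V

    vTerm : ℕ → ℕ → Carrier
    vTerm n k = sgn k * choose n k * risingAbove a (suc k) * risingAbove b (suc k)
                * rising a (3 ℕ.+ n ℕ.+ k) (n ∸ k) * risingAbove d k ⁻¹

    vCert : ℕ → ℕ → Carrier
    vCert n zero    = 0#
    vCert n (suc k) = sgn k * choose n k * risingAbove a (2 ℕ.+ k) * risingAbove b (2 ℕ.+ k)
                      * rising a (4 ℕ.+ n ℕ.+ k) (suc n ∸ k) * risingAbove d k ⁻¹

    vCoeff₁ vCoeff₀ : ℕ → Carrier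
    vCoeff₁ n = (x + ι (2 ℕ.+ n)) * (d + ι (suc n))
    vCoeff₀ n = (e + ι (suc n)) * (a + ι (3 ℕ.+ n) + ι n) * (a + ι (4 ℕ.+ n) + ι n)

    vSum : ℕ → Carrier
    vSum n = sum0to n (vTerm n)

    vTerm-suc≈ : ∀ n k → k ≤ n → vTerm (suc n) k ≈
      sgn k * (ι (suc n) * chooseUnit n k) * risingAbove a (suc k) * risingAbove b (suc k)
      * (rising a (4 ℕ.+ n ℕ.+ k) (n ∸ k) * (a + ι (4 ℕ.+ n) + ι n)) * risingAbove d k ⁻¹
    vTerm-suc≈ n k k≤n =
      *-congʳ (*-cong (*-congʳ (*-congʳ (*-congˡ (choose-suc≈ n k)))) (rising-∸-snoc a (4 ℕ.+ n) k≤n))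

    vTerm-shift≈ : ∀ n k → k ≤ n → (a + ι (3 ℕ.+ n) + ι n) * vTerm n k ≈
      sgn k * ((ι (suc n) - ι k) * chooseUnit n k) * risingAbove a (suc k) * risingAbove b (suc k)
      * ((a + ι (3 ℕ.+ n) + ι k) * rising a (4 ℕ.+ n ℕ.+ k) (n ∸ k)) * risingAbove d k ⁻¹
    vTerm-shift≈ n k k≤n = trans
      (solve 7 (λ c σ C p q R u → c ⊗ (σ ⊗ C ⊗ p ⊗ q ⊗ R ⊗ u) ⊜ σ ⊗ C ⊗ p ⊗ q ⊗ (c ⊗ R) ⊗ u)
        refl
        (a + ι (3 ℕ.+ n) + ι n) (sgn k) (choose n k) (risingAbove a (suc k)) (risingAbove b (suc k))
        (rising a (3 ℕ.+ n ℕ.+ k) (n ∸ k)) (risingAbove d k ⁻¹))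
      (*-congʳ (*-cong (*-congʳ (*-congʳ (*-congˡ (choose≈ n k)))) (rising-∸-shift a (3 ℕ.+ n) k≤n)))

    vCert-suc≈ : ∀ n k → k ≤ n → vCert n (suc k) ≈
      sgn k * ((ι (suc n) - ι k) * chooseUnit n k) * risingAbove a (2 ℕ.+ k) * risingAbove b (2 ℕ.+ k)
      * (rising a (4 ℕ.+ n ℕ.+ k) (n ∸ k) * (a + ι (4 ℕ.+ n) + ι n)) * risingAbove d k ⁻¹
    vCert-suc≈ n k k≤n =
      *-congʳ (*-cong (*-congʳ (*-congʳ (*-congˡ (choose≈ n k)))) (rising-∸-snoc a (4 ℕ.+ n) k≤n))

    vCert≈ : ∀ n k → k ≤ n → ¬ risingAbove d k ≈ 0# → vCert n k ≈
      (- sgn k) * (ι k * chooseUnit n k) * risingAbove a (suc k) * risingAbove b (suc k)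
      * ((a + ι (3 ℕ.+ n) + ι k) * (rising a (4 ℕ.+ n ℕ.+ k) (n ∸ k) * (a + ι (4 ℕ.+ n) + ι n)))
      * (risingAbove d k ⁻¹ * (d + ι k))
    vCert≈ n zero _ _ =
      solve 8 (λ σ u p q c T c′ w → Κ (+ 0) ⊜ (⊝ σ) ⊗ (Κ (+ 0) ⊗ u) ⊗ p ⊗ q ⊗ (c ⊗ (T ⊗ c′)) ⊗ w)
      refl (sgn 0) (chooseUnit n 0) (risingAbove a 1) (risingAbove b 1) (a + ι (3 ℕ.+ n) + ι 0)
      (rising a (4 ℕ.+ n ℕ.+ 0) n) (a + ι (4 ℕ.+ n) + ι n) (risingAbove d 0 ⁻¹ * (d + ι 0))
    vCert≈ n (suc j) j<n pd≉0 =
      *-cong (*-cong (*-congʳ (*-congʳ (*-cong (sgn≈-sgn-suc j) (choose-pred≈ n j)))) rising≈)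
             (⁻¹-of-factor pd≉0)
      where
      rising≈ : rising a (4 ℕ.+ n ℕ.+ j) (suc n ∸ j) ≈
        (a + ι (3 ℕ.+ n) + ι (suc j))
        * (rising a (4 ℕ.+ n ℕ.+ suc j) (n ∸ suc j) * (a + ι (4 ℕ.+ n) + ι n))
      rising≈ = begin
        rising a (4 ℕ.+ n ℕ.+ j) (suc n ∸ j)
          ≈⟨ rising-∸-uncons a (4 ℕ.+ n) (ℕP.m≤n⇒m≤1+n j<n) ⟩
        (a + ι (4 ℕ.+ n) + ι j) * rising a (4 ℕ.+ n ℕ.+ suc j) (n ∸ j)
          ≈⟨ *-cong (+ι-suc-swap a (3 ℕ.+ n) j) (rising-∸-snoc a (4 ℕ.+ n) j<n) ⟩
        (a + ι (3 ℕ.+ n) + ι (suc j))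
          * (rising a (4 ℕ.+ n ℕ.+ suc j) (n ∸ suc j) * (a + ι (4 ℕ.+ n) + ι n)) ∎

    vTerm-top : ∀ n → vTerm n (suc n) ≈ 0#
    vTerm-top n = trans (*-congʳ (*-congʳ (*-congʳ (*-congʳ (*-congˡ (choose-top n))))))
      (solve 5 (λ σ p q R u → σ ⊗ Κ (+ 0) ⊗ p ⊗ q ⊗ R ⊗ u ⊜ Κ (+ 0)) refl _ _ _ _ _)

    vCert-top : ∀ n → vCert n (suc (suc n)) ≈ 0#
    vCert-top n = trans (*-congʳ (*-congʳ (*-congʳ (*-congʳ (*-congˡ (choose-top n))))))
      (solve 5 (λ σ p q R u → σ ⊗ Κ (+ 0) ⊗ p ⊗ q ⊗ R ⊗ u ⊜ Κ (+ 0)) refl _ _ _ _ _)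

    vCertificate-below : ∀ n k → k ≤ n → ¬ risingAbove d k ≈ 0# →
      two * vCoeff₁ n * vTerm (suc n) k - two * vCoeff₀ n * vTerm n k ≈ vCert n (suc k) - vCert n k
    vCertificate-below n k k≤n pd≉0 = begin
      two * vCoeff₁ n * vTerm (suc n) k - two * vCoeff₀ n * vTerm n k
        ≈⟨ solve 5 (λ Q E c₃ c₄ X → Q ⊕ ⊝ (Κ (+ 2) ⊗ (E ⊗ c₃ ⊗ c₄) ⊗ X)
                                     ⊜ Q ⊕ ⊝ (Κ (+ 2) ⊗ (E ⊗ c₄) ⊗ (c₃ ⊗ X)))
             refl (two * vCoeff₁ n * vTerm (suc n) k) (e + ι (suc n)) (a + ι (3 ℕ.+ n) + ι n)
             (a + ι (4 ℕ.+ n) + ι n) (vTerm n k) ⟩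
      two * vCoeff₁ n * vTerm (suc n) k - two * ((e + ι (suc n)) * (a + ι (4 ℕ.+ n) + ι n))
                                              * ((a + ι (3 ℕ.+ n) + ι n) * vTerm n k)
        ≈⟨ +-cong (*-congˡ (vTerm-suc≈ n k k≤n)) (-‿cong (*-congˡ (vTerm-shift≈ n k k≤n))) ⟩
      _ ≈⟨ solve 10 (λ σ u pa pb T w x y ν κ →
             let a′ = Κ (+ 2) ⊗ x ; b′ = Κ (+ 2) ⊗ y ; d′ = a′ ⊕ ⊝ b′
                 e′ = x ⊕ ⊝ (Κ (+ 2) ⊗ y) ⊕ ⊝ 𝟏
                 c₃ = a′ ⊕ (3 ⊕ℕ ν) ⊕ ν ; c₄ = a′ ⊕ (4 ⊕ℕ ν) ⊕ ν ; c₃ₖ = a′ ⊕ (3 ⊕ℕ ν) ⊕ κ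
                 pa₁ = pa ⊗ (a′ ⊕ (1 ⊕ℕ κ)) ; pb₁ = pb ⊗ (b′ ⊕ (1 ⊕ℕ κ))
                 pa₂ = pa₁ ⊗ (a′ ⊕ (2 ⊕ℕ κ)) ; pb₂ = pb₁ ⊗ (b′ ⊕ (2 ⊕ℕ κ))
             in Κ (+ 2) ⊗ ((x ⊕ (2 ⊕ℕ ν)) ⊗ (d′ ⊕ (1 ⊕ℕ ν)))
                  ⊗ (σ ⊗ ((1 ⊕ℕ ν) ⊗ u) ⊗ pa₁ ⊗ pb₁ ⊗ (T ⊗ c₄) ⊗ w)
                ⊕ ⊝ (Κ (+ 2) ⊗ ((e′ ⊕ (1 ⊕ℕ ν)) ⊗ c₄)
                      ⊗ (σ ⊗ (((1 ⊕ℕ ν) ⊕ ⊝ κ) ⊗ u) ⊗ pa₁ ⊗ pb₁ ⊗ (c₃ₖ ⊗ T) ⊗ w))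
                ⊜ σ ⊗ (((1 ⊕ℕ ν) ⊕ ⊝ κ) ⊗ u) ⊗ pa₂ ⊗ pb₂ ⊗ (T ⊗ c₄) ⊗ w
                  ⊕ ⊝ ((⊝ σ) ⊗ (κ ⊗ u) ⊗ pa₁ ⊗ pb₁ ⊗ (c₃ₖ ⊗ (T ⊗ c₄)) ⊗ (w ⊗ (d′ ⊕ κ))))
           refl (sgn k) (chooseUnit n k) (risingAbove a k) (risingAbove b k)
           (rising a (4 ℕ.+ n ℕ.+ k) (n ∸ k)) (risingAbove d k ⁻¹) x y (ι n) (ι k) ⟩
      _ ≈⟨ +-cong (vCert-suc≈ n k k≤n) (-‿cong (vCert≈ n k k≤n pd≉0)) ⟨
      vCert n (suc k) - vCert n k ∎

    vCertificate-top : ∀ n → ¬ risingAbove d (suc n) ≈ 0# →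
      two * vCoeff₁ n * vTerm (suc n) (suc n) - two * vCoeff₀ n * vTerm n (suc n)
        ≈ vCert n (suc (suc n)) - vCert n (suc n)
    vCertificate-top n pd≉0 = begin
      two * vCoeff₁ n * vTerm (suc n) (suc n) - two * vCoeff₀ n * vTerm n (suc n)
        ≈⟨ +-cong (*-congˡ vTerm-diag≈) (-‿cong (*-congˡ (vTerm-top n))) ⟩
      _ ≈⟨ solve 8 (λ σ pa pb w x y ν R →
             let a′ = Κ (+ 2) ⊗ x ; d′ = a′ ⊕ ⊝ (Κ (+ 2) ⊗ y)
             in Κ (+ 2) ⊗ ((x ⊕ (2 ⊕ℕ ν)) ⊗ (d′ ⊕ (1 ⊕ℕ ν))) ⊗ (σ ⊗ 𝟏 ⊗ pa ⊗ pb ⊗ 𝟏 ⊗ w)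
                  ⊕ ⊝ (Κ (+ 2) ⊗ R ⊗ Κ (+ 0))
                ⊜ Κ (+ 0)
                  ⊕ ⊝ ((⊝ σ) ⊗ 𝟏 ⊗ pa ⊗ pb ⊗ ((a′ ⊕ (4 ⊕ℕ ν) ⊕ ν) ⊗ 𝟏) ⊗ (w ⊗ (d′ ⊕ (1 ⊕ℕ ν)))))
           refl (sgn (suc n)) (risingAbove a (2 ℕ.+ n)) (risingAbove b (2 ℕ.+ n)) (risingAbove d (suc n) ⁻¹)
           x y (ι n) (vCoeff₀ n) ⟩
      _ ≈⟨ +-cong (vCert-top n) (-‿cong vCert-diag≈) ⟨
      vCert n (suc (suc n)) - vCert n (suc n) ∎
      where
      vTerm-diag≈ : vTerm (suc n) (suc n) ≈
        sgn (suc n) * 1# * risingAbove a (2 ℕ.+ n) * risingAbove b (2 ℕ.+ n) * 1# * risingAbove d (suc n) ⁻¹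
      vTerm-diag≈ = *-congʳ (*-cong (*-congʳ (*-congʳ (*-congˡ (choose-diag (suc n)))))
                                    (reflexive (P.cong (rising a (4 ℕ.+ n ℕ.+ suc n)) (ℕP.n∸n≡0 n))))
      vCert-diag≈ : vCert n (suc n) ≈
        (- sgn (suc n)) * 1# * risingAbove a (2 ℕ.+ n) * risingAbove b (2 ℕ.+ n)
        * ((a + ι (4 ℕ.+ n) + ι n) * 1#) * (risingAbove d (suc n) ⁻¹ * (d + ι (suc n)))
      vCert-diag≈ = *-cong (*-cong (*-congʳ (*-congʳ (*-cong (sgn≈-sgn-suc n) (choose-diag n))))
                                   (trans (reflexive (P.cong (rising a (4 ℕ.+ n ℕ.+ n)) (ℕP.m+n∸n≡m 1 n)))
                                          (*-congʳ (+ι-+ a (4 ℕ.+ n) n))))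
                           (⁻¹-of-factor pd≉0)

    vCertificate : ∀ n k → k ≤ suc n → ¬ risingAbove d k ≈ 0# →
      two * vCoeff₁ n * vTerm (suc n) k - two * vCoeff₀ n * vTerm n k ≈ vCert n (suc k) - vCert n k
    vCertificate n k k≤1+n pd≉0 with ℕP.m≤n⇒m<n∨m≡n k≤1+n
    ... | inj₁ k<1+n  = vCertificate-below n k (ℕP.m<1+n⇒m≤n k<1+n) pd≉0
    ... | inj₂ P.refl = vCertificate-top n pd≉0

    vSum-recurrence : ∀ n → (∀ k → k ≤ suc n → ¬ risingAbove d k ≈ 0#) →
      vCoeff₁ n * vSum (suc n) ≈ vCoeff₀ n * vSum n
    vSum-recurrence n pd≉0 = −≈0⇒≈ (*-cancelˡ (charZero 1) (begin
      two * (vCoeff₁ n * vSum (suc n) - vCoeff₀ n * vSum n)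
        ≈⟨ solve 5 (λ t p q S₁ S₀ → t ⊗ (p ⊗ S₁ ⊕ ⊝ (q ⊗ S₀)) ⊜ t ⊗ p ⊗ S₁ ⊕ ⊝ (t ⊗ q ⊗ S₀))
             refl two (vCoeff₁ n) (vCoeff₀ n) (vSum (suc n)) (vSum n) ⟩
      two * vCoeff₁ n * vSum (suc n) - two * vCoeff₀ n * vSum n
        ≈⟨ sum0to-recurrence n (two * vCoeff₁ n) (two * vCoeff₀ n) (vTerm (suc n)) (vTerm n) _
             (vTerm-top n) (λ k k≤1+n → vCertificate n k k≤1+n (pd≉0 k k≤1+n)) ⟩
      sum0to (suc n) (λ k → vCert n (suc k) - vCert n k)
        ≈⟨ sum0to-telescope (suc n) (vCert n) ⟩
      vCert n (suc (suc n)) - 0#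
        ≈⟨ +-cong (vCert-top n) (-‿cong (sym (zeroʳ two))) ⟩
      0# - two * 0#
        ≈⟨ solve 1 (λ t → Κ (+ 0) ⊕ ⊝ (t ⊗ Κ (+ 0)) ⊜ t ⊗ Κ (+ 0)) refl two ⟩
      two * 0# ∎))

    risingOdd risingEven : ℕ → Carrier
    risingOdd  n = rising a 1 (1 ℕ.+ n ℕ.+ n)
    risingEven n = rising a 1 (2 ℕ.+ n ℕ.+ n)

    risingEven≈ : ∀ n → risingEven n ≈ risingOdd n * (a + ι (2 ℕ.+ n) + ι n)
    risingEven≈ n = trans (rising-snoc a 1 (1 ℕ.+ n ℕ.+ n)) (*-congˡ (+ι-+ a (2 ℕ.+ n) n))

    risingOdd-suc≈ : ∀ n → risingOdd (suc n) ≈ risingEven n * (a + ι (3 ℕ.+ n) + ι n)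
    risingOdd-suc≈ n = begin
      rising a 1 (2 ℕ.+ (n ℕ.+ suc n))
        ≡⟨ P.cong (λ m → rising a 1 (2 ℕ.+ m)) (ℕP.+-suc n n) ⟩
      rising a 1 (suc (2 ℕ.+ n ℕ.+ n))
        ≈⟨ rising-snoc a 1 (2 ℕ.+ n ℕ.+ n) ⟩
      risingEven n * (a + ι (3 ℕ.+ n ℕ.+ n))
        ≈⟨ *-congˡ (+ι-+ a (3 ℕ.+ n) n) ⟩
      risingEven n * (a + ι (3 ℕ.+ n) + ι n) ∎

    risingEven-suc≈ : ∀ n →
      risingEven (suc n) ≈ risingEven n * (a + ι (3 ℕ.+ n) + ι n) * (a + ι (4 ℕ.+ n) + ι n)
    risingEven-suc≈ n = trans (risingEven≈ (suc n))
      (*-cong (risingOdd-suc≈ n) (sym (+ι-suc-swap a (3 ℕ.+ n) n)))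

    vSum-closed : ∀ n → (∀ k → k ≤ n → ¬ risingAbove d k ≈ 0#) →
      two * risingAbove x (suc n) * risingAbove d n * vSum n ≈ (b + 1#) * risingEven n * risingAbove e n
    vSum-closed zero _ = trans (*-congˡ (*-congˡ 1⁻¹≈1))
      (solve 2 (λ x y → let a′ = Κ (+ 2) ⊗ x ; b′ = Κ (+ 2) ⊗ y in
          Κ (+ 2) ⊗ (𝟏 ⊗ (x ⊕ Κ (+ 1))) ⊗ 𝟏
            ⊗ (𝟏 ⊗ Κ (+ 1) ⊗ (𝟏 ⊗ (a′ ⊕ Κ (+ 1))) ⊗ (𝟏 ⊗ (b′ ⊕ Κ (+ 1))) ⊗ 𝟏 ⊗ 𝟏)
            ⊜ (b′ ⊕ 𝟏) ⊗ ((a′ ⊕ Κ (+ 1)) ⊗ ((a′ ⊕ Κ (+ 2)) ⊗ 𝟏)) ⊗ 𝟏)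
        refl x y)
    vSum-closed (suc n) pd≉0 = begin
      two * (px * (x + ι (2 ℕ.+ n))) * (pd * (d + ι (suc n))) * vSum (suc n)
        ≈⟨ solve 6 (λ px X pd D V t → t ⊗ (px ⊗ X) ⊗ (pd ⊗ D) ⊗ V ⊜ (t ⊗ px ⊗ pd) ⊗ ((X ⊗ D) ⊗ V))
             refl px (x + ι (2 ℕ.+ n)) pd (d + ι (suc n)) (vSum (suc n)) two ⟩
      (two * px * pd) * (vCoeff₁ n * vSum (suc n))
        ≈⟨ *-congˡ (vSum-recurrence n pd≉0) ⟩
      (two * px * pd) * (vCoeff₀ n * vSum n)
        ≈⟨ solve 3 (λ A R V → A ⊗ (R ⊗ V) ⊜ R ⊗ (A ⊗ V)) refl (two * px * pd) (vCoeff₀ n) (vSum n) ⟩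
      vCoeff₀ n * (two * px * pd * vSum n)
        ≈⟨ *-congˡ (vSum-closed n (λ k k≤n → pd≉0 k (ℕP.m≤n⇒m≤1+n k≤n))) ⟩
      vCoeff₀ n * ((b + 1#) * risingEven n * risingAbove e n)
        ≈⟨ solve 6 (λ E c₃ c₄ B R pe → (E ⊗ c₃ ⊗ c₄) ⊗ (B ⊗ R ⊗ pe) ⊜ B ⊗ (R ⊗ c₃ ⊗ c₄) ⊗ (pe ⊗ E))
             refl (e + ι (suc n)) (a + ι (3 ℕ.+ n) + ι n) (a + ι (4 ℕ.+ n) + ι n)
             (b + 1#) (risingEven n) (risingAbove e n) ⟩
      (b + 1#) * (risingEven n * (a + ι (3 ℕ.+ n) + ι n) * (a + ι (4 ℕ.+ n) + ι n)) * risingAbove e (suc n)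
        ≈⟨ *-congʳ (*-congˡ (risingEven-suc≈ n)) ⟨
      (b + 1#) * risingEven (suc n) * risingAbove e (suc n) ∎
      where
      px pd : Carrier
      px = risingAbove x (suc n)
      pd = risingAbove d n

    -- The harmonic sum S

    sTerm : ℕ → ℕ → Carrier
    sTerm n k = sgn k * choose n k * risingAbove a k * risingAbove b k * (1# + a + two * ι k)
                * rising a (2 ℕ.+ n ℕ.+ k) (n ∸ k) * risingAbove d k ⁻¹

    sCert : ℕ → ℕ → Carrier
    sCert n zero    = 0#
    sCert n (suc k) = (x + ι (suc k)) * (a + ι (3 ℕ.+ n) + ι n) * vTerm n k

    sCoeff₁ sCoeff₀ : ℕ → Carrier
    sCoeff₁ n = (x + ι (suc n)) * (d + ι (suc n))
    sCoeff₀ n = (e + ι (suc n)) * (a + ι (2 ℕ.+ n) + ι n) * (a + ι (3 ℕ.+ n) + ι n)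

    sSum : ℕ → Carrier
    sSum n = sum0to n (λ k → sTerm n k * H k x)

    sTerm-suc≈ : ∀ n k → k ≤ n → sTerm (suc n) k ≈
      sgn k * (ι (suc n) * chooseUnit n k) * risingAbove a k * risingAbove b k * (1# + a + two * ι k)
      * (rising a (3 ℕ.+ n ℕ.+ k) (n ∸ k) * (a + ι (3 ℕ.+ n) + ι n)) * risingAbove d k ⁻¹
    sTerm-suc≈ n k k≤n = *-congʳ (*-cong (*-congʳ (*-congʳ (*-congʳ (*-congˡ (choose-suc≈ n k)))))
                                         (rising-∸-snoc a (3 ℕ.+ n) k≤n))

    sTerm-shift≈ : ∀ n k → k ≤ n → (a + ι (2 ℕ.+ n) + ι n) * sTerm n k ≈
      sgn k * ((ι (suc n) - ι k) * chooseUnit n k) * risingAbove a k * risingAbove b k * (1# + a + two * ι k)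
      * ((a + ι (2 ℕ.+ n) + ι k) * rising a (3 ℕ.+ n ℕ.+ k) (n ∸ k)) * risingAbove d k ⁻¹
    sTerm-shift≈ n k k≤n = trans
      (solve 8 (λ c σ C p q L R u → c ⊗ (σ ⊗ C ⊗ p ⊗ q ⊗ L ⊗ R ⊗ u) ⊜ σ ⊗ C ⊗ p ⊗ q ⊗ L ⊗ (c ⊗ R) ⊗ u)
        refl
        (a + ι (2 ℕ.+ n) + ι n) (sgn k) (choose n k) (risingAbove a k) (risingAbove b k) (1# + a + two * ι k)
        (rising a (2 ℕ.+ n ℕ.+ k) (n ∸ k)) (risingAbove d k ⁻¹))
      (*-congʳ (*-cong (*-congʳ (*-congʳ (*-congʳ (*-congˡ (choose≈ n k)))))
                       (rising-∸-shift a (2 ℕ.+ n) k≤n)))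

    vTerm≈ : ∀ n k → vTerm n k ≈
      sgn k * ((ι (suc n) - ι k) * chooseUnit n k) * risingAbove a (suc k) * risingAbove b (suc k)
      * rising a (3 ℕ.+ n ℕ.+ k) (n ∸ k) * risingAbove d k ⁻¹
    vTerm≈ n k = *-congʳ (*-congʳ (*-congʳ (*-congʳ (*-congˡ (choose≈ n k)))))

    sCert≈ : ∀ n k → k ≤ n → ¬ risingAbove d k ≈ 0# → sCert n k ≈
      (x + ι k) * (a + ι (3 ℕ.+ n) + ι n)
      * ((- sgn k) * (ι k * chooseUnit n k) * risingAbove a k * risingAbove b k
         * ((a + ι (2 ℕ.+ n) + ι k) * rising a (3 ℕ.+ n ℕ.+ k) (n ∸ k))
         * (risingAbove d k ⁻¹ * (d + ι k)))
    sCert≈ n zero _ _ =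
      solve 9 (λ X c σ u p q c′ T w → Κ (+ 0) ⊜ X ⊗ c ⊗ ((⊝ σ) ⊗ (Κ (+ 0) ⊗ u) ⊗ p ⊗ q ⊗ (c′ ⊗ T) ⊗ w))
      refl (x + ι 0) (a + ι (3 ℕ.+ n) + ι n) (sgn 0) (chooseUnit n 0) (risingAbove a 0) (risingAbove b 0)
      (a + ι (2 ℕ.+ n) + ι 0) (rising a (3 ℕ.+ n ℕ.+ 0) n) (risingAbove d 0 ⁻¹ * (d + ι 0))
    sCert≈ n (suc j) j<n pd≉0 =
      *-congˡ (*-cong (*-cong (*-congʳ (*-congʳ (*-cong (sgn≈-sgn-suc j) (choose-pred≈ n j)))) rising≈)
                      (⁻¹-of-factor pd≉0))
      where
      rising≈ : rising a (3 ℕ.+ n ℕ.+ j) (n ∸ j) ≈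
        (a + ι (2 ℕ.+ n) + ι (suc j)) * rising a (3 ℕ.+ n ℕ.+ suc j) (n ∸ suc j)
      rising≈ = trans (rising-∸-uncons a (3 ℕ.+ n) j<n) (*-congʳ (+ι-suc-swap a (2 ℕ.+ n) j))

    sTerm-top : ∀ n → sTerm n (suc n) ≈ 0#
    sTerm-top n = trans (*-congʳ (*-congʳ (*-congʳ (*-congʳ (*-congʳ (*-congˡ (choose-top n)))))))
      (solve 6 (λ σ p q L R u → σ ⊗ Κ (+ 0) ⊗ p ⊗ q ⊗ L ⊗ R ⊗ u ⊜ Κ (+ 0)) refl _ _ _ _ _ _)

    sCert-top : ∀ n → sCert n (suc (suc n)) ≈ 0#
    sCert-top n = trans (*-congˡ (vTerm-top n)) (zeroʳ _)

    sCertificate-below : ∀ n k → k ≤ n → ¬ risingAbove d k ≈ 0# →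
      sCoeff₁ n * sTerm (suc n) k - sCoeff₀ n * sTerm n k ≈ sCert n (suc k) - sCert n k
    sCertificate-below n k k≤n pd≉0 = begin
      sCoeff₁ n * sTerm (suc n) k - sCoeff₀ n * sTerm n k
        ≈⟨ solve 5 (λ Q E c₂ c₃ X → Q ⊕ ⊝ (E ⊗ c₂ ⊗ c₃ ⊗ X) ⊜ Q ⊕ ⊝ (E ⊗ c₃ ⊗ (c₂ ⊗ X)))
             refl (sCoeff₁ n * sTerm (suc n) k) (e + ι (suc n)) (a + ι (2 ℕ.+ n) + ι n)
             (a + ι (3 ℕ.+ n) + ι n) (sTerm n k) ⟩
      sCoeff₁ n * sTerm (suc n) k
        - (e + ι (suc n)) * (a + ι (3 ℕ.+ n) + ι n) * ((a + ι (2 ℕ.+ n) + ι n) * sTerm n k)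
        ≈⟨ +-cong (*-congˡ (sTerm-suc≈ n k k≤n)) (-‿cong (*-congˡ (sTerm-shift≈ n k k≤n))) ⟩
      _ ≈⟨ solve 10 (λ σ u pa pb T w x y ν κ →
             let a′ = Κ (+ 2) ⊗ x ; b′ = Κ (+ 2) ⊗ y ; d′ = a′ ⊕ ⊝ b′
                 e′ = x ⊕ ⊝ (Κ (+ 2) ⊗ y) ⊕ ⊝ 𝟏
                 c₃ = a′ ⊕ (3 ⊕ℕ ν) ⊕ ν ; c₂ₖ = a′ ⊕ (2 ⊕ℕ ν) ⊕ κ
                 L = 𝟏 ⊕ a′ ⊕ Κ (+ 2) ⊗ κ
                 pa₁ = pa ⊗ (a′ ⊕ (1 ⊕ℕ κ)) ; pb₁ = pb ⊗ (b′ ⊕ (1 ⊕ℕ κ))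
             in (x ⊕ (1 ⊕ℕ ν)) ⊗ (d′ ⊕ (1 ⊕ℕ ν)) ⊗ (σ ⊗ ((1 ⊕ℕ ν) ⊗ u) ⊗ pa ⊗ pb ⊗ L ⊗ (T ⊗ c₃) ⊗ w)
                ⊕ ⊝ ((e′ ⊕ (1 ⊕ℕ ν)) ⊗ c₃
                      ⊗ (σ ⊗ (((1 ⊕ℕ ν) ⊕ ⊝ κ) ⊗ u) ⊗ pa ⊗ pb ⊗ L ⊗ (c₂ₖ ⊗ T) ⊗ w))
                ⊜ (x ⊕ (1 ⊕ℕ κ)) ⊗ c₃ ⊗ (σ ⊗ (((1 ⊕ℕ ν) ⊕ ⊝ κ) ⊗ u) ⊗ pa₁ ⊗ pb₁ ⊗ T ⊗ w)
                  ⊕ ⊝ ((x ⊕ κ) ⊗ c₃ ⊗ ((⊝ σ) ⊗ (κ ⊗ u) ⊗ pa ⊗ pb ⊗ (c₂ₖ ⊗ T) ⊗ (w ⊗ (d′ ⊕ κ)))))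
           refl (sgn k) (chooseUnit n k) (risingAbove a k) (risingAbove b k)
           (rising a (3 ℕ.+ n ℕ.+ k) (n ∸ k)) (risingAbove d k ⁻¹) x y (ι n) (ι k) ⟩
      _ ≈⟨ +-cong (*-congˡ (vTerm≈ n k)) (-‿cong (sCert≈ n k k≤n pd≉0)) ⟨
      sCert n (suc k) - sCert n k ∎

    sCertificate-top : ∀ n → ¬ risingAbove d (suc n) ≈ 0# →
      sCoeff₁ n * sTerm (suc n) (suc n) - sCoeff₀ n * sTerm n (suc n) ≈ sCert n (suc (suc n)) - sCert n (suc n)
    sCertificate-top n pd≉0 = begin
      sCoeff₁ n * sTerm (suc n) (suc n) - sCoeff₀ n * sTerm n (suc n)
        ≈⟨ +-cong (*-congˡ sTerm-diag≈) (-‿cong (*-congˡ (sTerm-top n))) ⟩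
      _ ≈⟨ solve 8 (λ σ pa pb w x y ν R →
             let a′ = Κ (+ 2) ⊗ x ; d′ = a′ ⊕ ⊝ (Κ (+ 2) ⊗ y)
             in (x ⊕ (1 ⊕ℕ ν)) ⊗ (d′ ⊕ (1 ⊕ℕ ν))
                  ⊗ (σ ⊗ 𝟏 ⊗ pa ⊗ pb ⊗ (𝟏 ⊕ a′ ⊕ Κ (+ 2) ⊗ (1 ⊕ℕ ν)) ⊗ 𝟏 ⊗ w)
                ⊕ ⊝ (R ⊗ Κ (+ 0))
                ⊜ Κ (+ 0) ⊕ ⊝ ((x ⊕ (1 ⊕ℕ ν)) ⊗ (a′ ⊕ (3 ⊕ℕ ν) ⊕ ν)
                                ⊗ ((⊝ σ) ⊗ 𝟏 ⊗ pa ⊗ pb ⊗ 𝟏 ⊗ (w ⊗ (d′ ⊕ (1 ⊕ℕ ν))))))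
           refl (sgn (suc n)) (risingAbove a (suc n)) (risingAbove b (suc n)) (risingAbove d (suc n) ⁻¹)
           x y (ι n) (sCoeff₀ n) ⟩
      _ ≈⟨ +-cong (sCert-top n) (-‿cong (*-congˡ vTerm-diag≈)) ⟨
      sCert n (suc (suc n)) - sCert n (suc n) ∎
      where
      sTerm-diag≈ : sTerm (suc n) (suc n) ≈ sgn (suc n) * 1# * risingAbove a (suc n) * risingAbove b (suc n)
                                              * (1# + a + two * ι (suc n)) * 1# * risingAbove d (suc n) ⁻¹
      sTerm-diag≈ = *-congʳ (*-cong (*-congʳ (*-congʳ (*-congʳ (*-congˡ (choose-diag (suc n))))))
                                    (reflexive (P.cong (rising a (3 ℕ.+ n ℕ.+ suc n)) (ℕP.n∸n≡0 n))))
      vTerm-diag≈ : vTerm n n ≈ (- sgn (suc n)) * 1# * risingAbove a (suc n) * risingAbove b (suc n) * 1#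
                                * (risingAbove d (suc n) ⁻¹ * (d + ι (suc n)))
      vTerm-diag≈ = *-cong (*-cong (*-congʳ (*-congʳ (*-cong (sgn≈-sgn-suc n) (choose-diag n))))
                                   (reflexive (P.cong (rising a (3 ℕ.+ n ℕ.+ n)) (ℕP.n∸n≡0 n))))
                           (⁻¹-of-factor pd≉0)

    sCertificate : ∀ n k → k ≤ suc n → ¬ risingAbove d k ≈ 0# →
      sCoeff₁ n * sTerm (suc n) k - sCoeff₀ n * sTerm n k ≈ sCert n (suc k) - sCert n k
    sCertificate n k k≤1+n pd≉0 with ℕP.m≤n⇒m<n∨m≡n k≤1+n
    ... | inj₁ k<1+n  = sCertificate-below n k (ℕP.m<1+n⇒m≤n k<1+n) pd≉0
    ... | inj₂ P.refl = sCertificate-top n pd≉0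

    sSum-recurrence : ∀ n → (∀ k → k ≤ suc n → ¬ risingAbove d k ≈ 0#) →
      (∀ k → k ≤ n → ¬ x + ι (suc k) ≈ 0#) →
      sCoeff₁ n * sSum (suc n) - sCoeff₀ n * sSum n ≈ - ((a + ι (3 ℕ.+ n) + ι n) * vSum n)
    sSum-recurrence n pd≉0 X≉0 = begin
      sCoeff₁ n * sSum (suc n) - sCoeff₀ n * sSum n
        ≈⟨ sum0to-recurrence n (sCoeff₁ n) (sCoeff₀ n) (λ k → sTerm (suc n) k * H k x)
             (λ k → sTerm n k * H k x) (λ k → (sCert n (suc k) - sCert n k) * H k x)
             (trans (*-congʳ (sTerm-top n)) (zeroˡ _)) weighted-certificate ⟩
      sum0to (suc n) (λ k → (sCert n (suc k) - sCert n k) * H k x)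
        ≈⟨ sum0to-by-parts n (sCert n) (λ k → H k x) ⟩
      sCert n (suc (suc n)) * H (suc n) x - 0# * 0#
        - sum0to n (λ k → sCert n (suc k) * (H (suc k) x - H k x))
        ≈⟨ +-cong (+-congʳ (*-congʳ (sCert-top n))) (-‿cong (sum0to-cong n harmonic-step)) ⟩
      0# * H (suc n) x - 0# * 0# - sum0to n (λ k → c₃ * vTerm n k)
        ≈⟨ +-congˡ (-‿cong (sum0to-*ˡ n c₃ (vTerm n))) ⟩
      0# * H (suc n) x - 0# * 0# - c₃ * vSum n
        ≈⟨ solve 2 (λ h V → Κ (+ 0) ⊗ h ⊕ ⊝ (Κ (+ 0) ⊗ Κ (+ 0)) ⊕ ⊝ V ⊜ ⊝ V) refl (H (suc n) x) (c₃ * vSum n) ⟩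
      - (c₃ * vSum n) ∎
      where
      c₃ : Carrier
      c₃ = a + ι (3 ℕ.+ n) + ι n
      weighted-certificate : ∀ k → k ≤ suc n →
        sCoeff₁ n * (sTerm (suc n) k * H k x) - sCoeff₀ n * (sTerm n k * H k x)
          ≈ (sCert n (suc k) - sCert n k) * H k x
      weighted-certificate k k≤1+n = trans
        (solve 5 (λ p q F₁ F₀ h → p ⊗ (F₁ ⊗ h) ⊕ ⊝ (q ⊗ (F₀ ⊗ h)) ⊜ (p ⊗ F₁ ⊕ ⊝ (q ⊗ F₀)) ⊗ h)
          refl (sCoeff₁ n) (sCoeff₀ n) (sTerm (suc n) k) (sTerm n k) (H k x))
        (*-congʳ (sCertificate n k k≤1+n (pd≉0 k k≤1+n)))
      harmonic-step : ∀ k → k ≤ n → sCert n (suc k) * (H (suc k) x - H k x) ≈ c₃ * vTerm n k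
      harmonic-step k k≤n = begin
        X * c₃ * vTerm n k * ((H k x + X ⁻¹) - H k x)
          ≈⟨ solve 5 (λ X c v h i → X ⊗ c ⊗ v ⊗ ((h ⊕ i) ⊕ ⊝ h) ⊜ c ⊗ v ⊗ (X ⊗ i))
               refl X c₃ (vTerm n k) (H k x) (X ⁻¹) ⟩
        c₃ * vTerm n k * (X * X ⁻¹)   ≈⟨ *-congˡ (inverseʳ X (X≉0 k k≤n)) ⟩
        c₃ * vTerm n k * 1#           ≈⟨ *-identityʳ _ ⟩
        c₃ * vTerm n k                ∎
        where
        X : Carrier
        X = x + ι (suc k)

    hDiff : ℕ → Carrier
    hDiff n = risingAbove x n * risingAbove e n * (H n x - H n e)

    hDiff-suc : ∀ n → ¬ x + ι (suc n) ≈ 0# → ¬ e + ι (suc n) ≈ 0# →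
      hDiff (suc n) ≈ (x + ι (suc n)) * (e + ι (suc n)) * hDiff n
                      + risingAbove x n * risingAbove e n * ((e + ι (suc n)) - (x + ι (suc n)))
    hDiff-suc n X≉0 E≉0 = begin
      risingAbove x n * X * (risingAbove e n * E) * ((H n x + X ⁻¹) - (H n e + E ⁻¹))
        ≈⟨ solve 8 (λ px X pe E hx he iX iE →
              px ⊗ X ⊗ (pe ⊗ E) ⊗ ((hx ⊕ iX) ⊕ ⊝ (he ⊕ iE))
                ⊜ X ⊗ E ⊗ (px ⊗ pe ⊗ (hx ⊕ ⊝ he)) ⊕ px ⊗ pe ⊗ (E ⊗ (X ⊗ iX) ⊕ ⊝ (X ⊗ (E ⊗ iE))))
             refl (risingAbove x n) X (risingAbove e n) E (H n x) (H n e) (X ⁻¹) (E ⁻¹) ⟩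
      X * E * hDiff n + risingAbove x n * risingAbove e n * (E * (X * X ⁻¹) - X * (E * E ⁻¹))
        ≈⟨ +-congˡ (*-congˡ (+-cong (*-congˡ (inverseʳ X X≉0)) (-‿cong (*-congˡ (inverseʳ E E≉0))))) ⟩
      X * E * hDiff n + risingAbove x n * risingAbove e n * (E * 1# - X * 1#)
        ≈⟨ +-congˡ (*-congˡ (+-cong (*-identityʳ E) (-‿cong (*-identityʳ X)))) ⟩
      X * E * hDiff n + risingAbove x n * risingAbove e n * (E - X) ∎
      where
      X E : Carrier
      X = x + ι (suc n)
      E = e + ι (suc n)

    sSum-suc-expansion : ∀ n → (∀ k → k ≤ suc n → ¬ risingAbove d k ≈ 0#) →
      (∀ k → k ≤ n → ¬ x + ι (suc k) ≈ 0#) →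
      two * risingAbove x (suc n) * risingAbove x (suc n) * risingAbove d (suc n) * risingAbove e (suc n)
        * sSum (suc n)
      ≈ (x + ι (suc n)) * (e + ι (suc n)) * sCoeff₀ n
          * (two * risingAbove x n * risingAbove x n * risingAbove d n * risingAbove e n * sSum n)
        - (e + ι (suc n)) * (a + ι (3 ℕ.+ n) + ι n) * risingAbove x n * risingAbove e n
          * (two * risingAbove x (suc n) * risingAbove d n * vSum n)
    sSum-suc-expansion n pd≉0 X≉0 = begin
      two * (px * X) * (px * X) * (pd * D) * (pe * E) * sSum (suc n)
        ≈⟨ solve 8 (λ t px X pd D pe E S → t ⊗ (px ⊗ X) ⊗ (px ⊗ X) ⊗ (pd ⊗ D) ⊗ (pe ⊗ E) ⊗ S
                                           ⊜ (t ⊗ px ⊗ px ⊗ pd ⊗ pe ⊗ X ⊗ E) ⊗ ((X ⊗ D) ⊗ S))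
             refl two px X pd D pe E (sSum (suc n)) ⟩
      (two * px * px * pd * pe * X * E) * (sCoeff₁ n * sSum (suc n))
        ≈⟨ *-congˡ (−≈-⇒≈− (sSum-recurrence n pd≉0 X≉0)) ⟩
      (two * px * px * pd * pe * X * E) * (sCoeff₀ n * sSum n - c₃ * vSum n)
        ≈⟨ solve 10 (λ t px pd pe X E R c S V →
              (t ⊗ px ⊗ px ⊗ pd ⊗ pe ⊗ X ⊗ E) ⊗ (R ⊗ S ⊕ ⊝ (c ⊗ V))
                ⊜ X ⊗ E ⊗ R ⊗ (t ⊗ px ⊗ px ⊗ pd ⊗ pe ⊗ S) ⊕ ⊝ (E ⊗ c ⊗ px ⊗ pe ⊗ (t ⊗ (px ⊗ X) ⊗ pd ⊗ V)))
             refl two px pd pe X E (sCoeff₀ n) c₃ (sSum n) (vSum n) ⟩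
      X * E * sCoeff₀ n * (two * px * px * pd * pe * sSum n)
        - E * c₃ * px * pe * (two * (px * X) * pd * vSum n) ∎
      where
      px pd pe X D E c₃ : Carrier
      px = risingAbove x n
      pd = risingAbove d n
      pe = risingAbove e n
      X = x + ι (suc n)
      D = d + ι (suc n)
      E = e + ι (suc n)
      c₃ = a + ι (3 ℕ.+ n) + ι n

    sSum-closed : ∀ n → (∀ k → k ≤ n → ¬ risingAbove d k ≈ 0#) →
      (∀ j → suc j ≤ n → ¬ x + ι (suc j) ≈ 0#) → (∀ j → suc j ≤ n → ¬ e + ι (suc j) ≈ 0#) →
      two * risingAbove x n * risingAbove x n * risingAbove d n * risingAbove e n * sSum n
        ≈ risingOdd n * risingAbove e n * hDiff n
    sSum-closed zero _ _ _ =
      solve 2 (λ s O → Κ (+ 2) ⊗ 𝟏 ⊗ 𝟏 ⊗ 𝟏 ⊗ 𝟏 ⊗ (s ⊗ Κ (+ 0)) ⊜ O ⊗ 𝟏 ⊗ (𝟏 ⊗ 𝟏 ⊗ (Κ (+ 0) ⊕ ⊝ Κ (+ 0))))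
        refl (sTerm 0 0) (risingOdd 0)
    sSum-closed (suc n) pd≉0 X≉0 E≉0 = begin
      two * (px * X) * (px * X) * (pd * D) * (pe * E) * sSum (suc n)
        ≈⟨ sSum-suc-expansion n pd≉0 (λ k k≤n → X≉0 k (s≤s k≤n)) ⟩
      X * E * sCoeff₀ n * (two * px * px * pd * pe * sSum n) - E * c₃ * px * pe * (two * (px * X) * pd * vSum n)
        ≈⟨ +-cong (*-congˡ (sSum-closed n pd≉0↓ (λ j j<n → X≉0 j (ℕP.m≤n⇒m≤1+n j<n))
                                            (λ j j<n → E≉0 j (ℕP.m≤n⇒m≤1+n j<n))))
                  (-‿cong (*-congˡ (trans (vSum-closed n pd≉0↓) (*-congʳ (*-congˡ (risingEven≈ n)))))) ⟩
      X * E * sCoeff₀ n * (risingOdd n * pe * hDiff n)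
        - E * c₃ * px * pe * ((b + 1#) * (risingOdd n * (a + ι (2 ℕ.+ n) + ι n)) * pe)
        -- closes because E − X = −(b + 1)
        ≈⟨ solve 7 (λ O pe h px x y ν →
             let a′ = Κ (+ 2) ⊗ x ; b′ = Κ (+ 2) ⊗ y ; e′ = x ⊕ ⊝ (Κ (+ 2) ⊗ y) ⊕ ⊝ 𝟏
                 X = x ⊕ (1 ⊕ℕ ν) ; E = e′ ⊕ (1 ⊕ℕ ν)
                 c₂ = a′ ⊕ (2 ⊕ℕ ν) ⊕ ν ; c₃ = a′ ⊕ (3 ⊕ℕ ν) ⊕ ν
             in X ⊗ E ⊗ (E ⊗ c₂ ⊗ c₃) ⊗ (O ⊗ pe ⊗ h) ⊕ ⊝ (E ⊗ c₃ ⊗ px ⊗ pe ⊗ ((b′ ⊕ 𝟏) ⊗ (O ⊗ c₂) ⊗ pe))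
                ⊜ (O ⊗ c₂ ⊗ c₃) ⊗ (pe ⊗ E) ⊗ (X ⊗ E ⊗ h ⊕ px ⊗ pe ⊗ (E ⊕ ⊝ X)))
           refl (risingOdd n) pe (hDiff n) px x y (ι n) ⟩
      risingOdd n * (a + ι (2 ℕ.+ n) + ι n) * c₃ * (pe * E) * (X * E * hDiff n + px * pe * (E - X))
        ≈⟨ *-cong (*-congʳ (trans (risingOdd-suc≈ n) (*-congʳ (risingEven≈ n))))
                  (hDiff-suc n (X≉0 n ℕP.≤-refl) (E≉0 n ℕP.≤-refl)) ⟨
      risingOdd (suc n) * (pe * E) * hDiff (suc n) ∎
      where
      px pd pe X D E c₃ : Carrier
      px = risingAbove x n
      pd = risingAbove d n
      pe = risingAbove e n
      X = x + ι (suc n)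
      D = d + ι (suc n)
      E = e + ι (suc n)
      c₃ = a + ι (3 ℕ.+ n) + ι n
      pd≉0↓ : ∀ k → k ≤ n → ¬ risingAbove d k ≈ 0#
      pd≉0↓ k k≤n = pd≉0 k (ℕP.m≤n⇒m≤1+n k≤n)

    -- Clearing denominators

    W : ℕ → Carrier
    W N = rising a (suc N) (suc N)

    W-nonzero : ∀ N → (∀ k → k ≤ N → ¬ 1# + a + ι N + ι k ≈ 0#) → ¬ W N ≈ 0#
    W-nonzero N factors≉0 = rising-nonzero a (suc N) (suc N) λ j j≤N ≈0 →
      factors≉0 j (ℕP.m<1+n⇒m≤n j≤N) (begin
        1# + a + ι N + ι j        ≈⟨ solve 3 (λ a ν κ → 𝟏 ⊕ a ⊕ ν ⊕ κ ⊜ a ⊕ (𝟏 ⊕ (ν ⊕ κ))) refl a (ι N) (ι j) ⟩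
        a + (1# + (ι N + ι j))    ≈⟨ +-congˡ (+-congˡ (ι-+ N j)) ⟨
        a + ι (suc N ℕ.+ j)       ≈⟨ ≈0 ⟩
        0#                        ∎)

    W-split : ∀ N k → k ≤ N →
      W N ≈ risingAbove (a + ι N) k * ((1# + a + ι N + ι k) * rising a (2 ℕ.+ N ℕ.+ k) (N ∸ k))
    W-split N k k≤N = begin
      rising a (suc N) (suc N)
        ≡⟨ P.cong (rising a (suc N)) length≡ ⟨
      rising a (suc N) (k ℕ.+ suc (N ∸ k))
        ≈⟨ rising-++ a (suc N) k (suc (N ∸ k)) ⟩
      rising a (suc N) k * ((a + ι (suc N ℕ.+ k)) * rising a (2 ℕ.+ N ℕ.+ k) (N ∸ k))
        ≈⟨ *-cong start≈ (*-congʳ far≈) ⟩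
      risingAbove (a + ι N) k * ((1# + a + ι N + ι k) * rising a (2 ℕ.+ N ℕ.+ k) (N ∸ k)) ∎
      where
      length≡ : k ℕ.+ suc (N ∸ k) P.≡ suc N
      length≡ = P.trans (ℕP.+-suc k (N ∸ k)) (P.cong suc (ℕP.m+[n∸m]≡n k≤N))
      start≈ : rising a (suc N) k ≈ risingAbove (a + ι N) k
      start≈ = begin
        rising a (suc N) k          ≡⟨ P.cong (λ i → rising a i k) (ℕP.+-comm N 1) ⟨
        rising a (N ℕ.+ 1) k        ≈⟨ rising-+ι a N 1 k ⟨
        rising (a + ι N) 1 k        ≈⟨ risingAbove≈rising (a + ι N) k ⟨
        risingAbove (a + ι N) k     ∎
      far≈ : a + ι (suc N ℕ.+ k) ≈ 1# + a + ι N + ι k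
      far≈ = trans (+-congˡ (+-congˡ (ι-+ N k)))
                   (solve 3 (λ a ν κ → a ⊕ (𝟏 ⊕ (ν ⊕ κ)) ⊜ 𝟏 ⊕ a ⊕ ν ⊕ κ) refl a (ι N) (ι k))

    summand-rescaled : ∀ N k → k ≤ N →
      ¬ binom (a + ι N + ι k) k ≈ 0# → ¬ binom (d + ι k) k ≈ 0# → ¬ 1# + a + ι N + ι k ≈ 0# →
      W N * (sgn k * choose N k
             * ((binom (a + ι k) k * binom (b + ι k) k) ÷ (binom (a + ι N + ι k) k * binom (d + ι k) k))
             * ((1# + a + two * ι k) ÷ (1# + a + ι N + ι k)) * H k x)
        ≈ sTerm N k * H k x
    summand-rescaled N k k≤N pA-binom≉0 pd-binom≉0 D≉0 = begin
      W N * (σ * Cₙₖ * ratio * (L * D ⁻¹) * h)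
        ≈⟨ *-cong (W-split N k k≤N) (*-congʳ (*-congʳ (*-congˡ ratio≈))) ⟩
      (pA * (D * T)) * (σ * Cₙₖ * (pa * pb * (pA ⁻¹ * pd ⁻¹)) * (L * D ⁻¹) * h)
        ≈⟨ solve 12 (λ pA D T σ Cₙₖ pa pb iA id L iD h →
             (pA ⊗ (D ⊗ T)) ⊗ (σ ⊗ Cₙₖ ⊗ (pa ⊗ pb ⊗ (iA ⊗ id)) ⊗ (L ⊗ iD) ⊗ h)
               ⊜ (σ ⊗ Cₙₖ ⊗ pa ⊗ pb ⊗ L ⊗ T ⊗ id ⊗ h) ⊗ ((pA ⊗ iA) ⊗ (D ⊗ iD)))
           refl pA D T σ Cₙₖ pa pb (pA ⁻¹) (pd ⁻¹) L (D ⁻¹) h ⟩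
      (σ * Cₙₖ * pa * pb * L * T * pd ⁻¹ * h) * ((pA * pA ⁻¹) * (D * D ⁻¹))
        ≈⟨ *-congˡ (trans (*-cong (inverseʳ pA pA≉0) (inverseʳ D D≉0)) (*-identityˡ 1#)) ⟩
      (σ * Cₙₖ * pa * pb * L * T * pd ⁻¹ * h) * 1#
        ≈⟨ *-identityʳ _ ⟩
      sTerm N k * h ∎
      where
      σ Cₙₖ h L D T pA pa pb pd ratio : Carrier
      σ = sgn k
      Cₙₖ = choose N k
      h = H k x
      L = 1# + a + two * ι k
      D = 1# + a + ι N + ι k
      T = rising a (2 ℕ.+ N ℕ.+ k) (N ∸ k)
      pA = risingAbove (a + ι N) k
      pa = risingAbove a k
      pb = risingAbove b k
      pd = risingAbove d k
      ratio = (binom (a + ι k) k * binom (b + ι k) k) ÷ (binom (a + ι N + ι k) k * binom (d + ι k) k)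
      pA≉0 : ¬ pA ≈ 0#
      pA≉0 = binom≉0⇒risingAbove≉0 (a + ι N) k pA-binom≉0
      ratio≈ : ratio ≈ pa * pb * (pA ⁻¹ * pd ⁻¹)
      ratio≈ = ratio-cancel (binom≈risingAbove a k) (binom≈risingAbove b k) (binom≈risingAbove (a + ι N) k)
                            (binom≈risingAbove d k) (⁻¹-nonzero (ι-nonzero (ℕP.1≤n! k))) pA≉0
                            (binom≉0⇒risingAbove≉0 d k pd-binom≉0)

    sum-rescaled : ∀ N →
      (∀ k → k ≤ N → ¬ binom (a + ι N + ι k) k ≈ 0#) → (∀ k → k ≤ N → ¬ binom (d + ι k) k ≈ 0#) →
      (∀ k → k ≤ N → ¬ 1# + a + ι N + ι k ≈ 0#) →
      sum0to N (λ k → sgn k * choose N k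
                      * ((binom (a + ι k) k * binom (b + ι k) k) ÷ (binom (a + ι N + ι k) k * binom (d + ι k) k))
                      * ((1# + a + two * ι k) ÷ (1# + a + ι N + ι k)) * H k x)
        ≈ W N ⁻¹ * sSum N
    sum-rescaled N pA≉0 pd≉0 D≉0 = trans
      (sum0to-cong N λ k k≤N → *-cancelˡ W≉0
        (trans (summand-rescaled N k k≤N (pA≉0 k k≤N) (pd≉0 k k≤N) (D≉0 k k≤N))
               (sym (*-inverse-cancelˡ (sTerm N k * H k x) W≉0))))
      (sum0to-*ˡ N (W N ⁻¹) (λ k → sTerm N k * H k x))
      where
      W≉0 : ¬ W N ≈ 0#
      W≉0 = W-nonzero N D≉0

    risingOdd≈ : ∀ N → risingOdd N ≈ risingAbove a N * W N
    risingOdd≈ N = begin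
      rising a 1 (1 ℕ.+ N ℕ.+ N)          ≡⟨ P.cong (rising a 1) (ℕP.+-suc N N) ⟨
      rising a 1 (N ℕ.+ suc N)            ≈⟨ rising-++ a 1 N (suc N) ⟩
      rising a 1 N * W N                  ≈⟨ *-congʳ (risingAbove≈rising a N) ⟨
      risingAbove a N * W N               ∎

    scale : ℕ → Carrier
    scale N = two * risingAbove x N * risingAbove x N * risingAbove d N * risingAbove e N * W N

    scale-sSum : ∀ N → (∀ k → k ≤ N → ¬ risingAbove d k ≈ 0#) → ¬ W N ≈ 0# →
      (∀ j → suc j ≤ N → ¬ x + ι (suc j) ≈ 0#) → (∀ j → suc j ≤ N → ¬ e + ι (suc j) ≈ 0#) →
      scale N * (W N ⁻¹ * sSum N) ≈ risingAbove a N * W N * risingAbove e N * hDiff N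
    scale-sSum N pd≉0 W≉0 X≉0 E≉0 = begin
      K * W N * (W N ⁻¹ * sSum N)
        ≈⟨ solve 4 (λ K w i S → K ⊗ w ⊗ (i ⊗ S) ⊜ w ⊗ (i ⊗ (K ⊗ S))) refl K (W N) (W N ⁻¹) (sSum N) ⟩
      W N * (W N ⁻¹ * (K * sSum N))              ≈⟨ *-inverse-cancelˡ _ W≉0 ⟩
      K * sSum N                                 ≈⟨ sSum-closed N pd≉0 X≉0 E≉0 ⟩
      risingOdd N * risingAbove e N * hDiff N    ≈⟨ *-congʳ (*-congʳ (risingOdd≈ N)) ⟩
      risingAbove a N * W N * risingAbove e N * hDiff N ∎
      where
      K : Carrier
      K = two * risingAbove x N * risingAbove x N * risingAbove d N * risingAbove e N

    scale-rhs : ∀ N → ¬ risingAbove x N ≈ 0# → ¬ risingAbove d N ≈ 0# →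
      scale N * ((1# ÷ two) * (risingAbove a N * risingAbove e N * (risingAbove x N ⁻¹ * risingAbove d N ⁻¹))
                 * (H N x - H N e))
        ≈ risingAbove a N * W N * risingAbove e N * hDiff N
    scale-rhs N px≉0 pd≉0 = begin
      scale N * ((1# ÷ two) * (pa * pe * (px ⁻¹ * pd ⁻¹)) * (H N x - H N e))
        ≈⟨ solve 10 (λ t pa w pe px pd Δ i₂ ipx ipd →
              (t ⊗ px ⊗ px ⊗ pd ⊗ pe ⊗ w) ⊗ ((𝟏 ⊗ i₂) ⊗ (pa ⊗ pe ⊗ (ipx ⊗ ipd)) ⊗ Δ)
                ⊜ (t ⊗ i₂) ⊗ (px ⊗ ipx) ⊗ (pd ⊗ ipd) ⊗ (pa ⊗ w ⊗ pe ⊗ (px ⊗ pe ⊗ Δ)))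
           refl two pa (W N) pe px pd (H N x - H N e) (two ⁻¹) (px ⁻¹) (pd ⁻¹) ⟩
      (two * two ⁻¹) * (px * px ⁻¹) * (pd * pd ⁻¹) * (pa * W N * pe * hDiff N)
        ≈⟨ *-congʳ (*-cong (*-cong (inverseʳ two (charZero 1)) (inverseʳ px px≉0)) (inverseʳ pd pd≉0)) ⟩
      1# * 1# * 1# * (pa * W N * pe * hDiff N)
        ≈⟨ solve 1 (λ z → 𝟏 ⊗ 𝟏 ⊗ 𝟏 ⊗ z ⊜ z) refl (pa * W N * pe * hDiff N) ⟩
      pa * W N * pe * hDiff N ∎
      where
      pa px pd pe : Carrier
      pa = risingAbove a N
      px = risingAbove x N
      pd = risingAbove d N
      pe = risingAbove e N

    closed-form : ∀ N →
      (∀ k → k ≤ N → ¬ binom (d + ι k) k ≈ 0#) → (∀ k → k ≤ N → ¬ 1# + a + ι N + ι k ≈ 0#) →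
      (∀ j → suc j ≤ N → ¬ x + ι (suc j) ≈ 0#) → (∀ j → suc j ≤ N → ¬ e + ι (suc j) ≈ 0#) →
      ¬ binom (x + ι N) N ≈ 0# →
      W N ⁻¹ * sSum N
        ≈ (1# ÷ two) * ((binom (a + ι N) N * binom (e + ι N) N) ÷ (binom (x + ι N) N * binom (d + ι N) N))
          * (H N x - H N e)
    closed-form N pd≉0 D≉0 X≉0 E≉0 px-binom≉0 = *-cancelˡ scale≉0 (begin
      scale N * (W N ⁻¹ * sSum N)
        ≈⟨ scale-sSum N pd≉0′ W≉0 X≉0 E≉0 ⟩
      risingAbove a N * W N * pe * hDiff N
        ≈⟨ scale-rhs N px≉0 (pd≉0′ N ℕP.≤-refl) ⟨
      scale N * ((1# ÷ two) * (risingAbove a N * pe * (px ⁻¹ * pd ⁻¹)) * (H N x - H N e))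
        ≈⟨ *-congˡ (*-congʳ (*-congˡ ratio≈)) ⟨
      scale N * ((1# ÷ two) * ((binom (a + ι N) N * binom (e + ι N) N) ÷ (binom (x + ι N) N * binom (d + ι N) N))
                 * (H N x - H N e)) ∎)
      where
      px pd pe : Carrier
      px = risingAbove x N
      pd = risingAbove d N
      pe = risingAbove e N
      W≉0 : ¬ W N ≈ 0#
      W≉0 = W-nonzero N D≉0
      px≉0 : ¬ px ≈ 0#
      px≉0 = binom≉0⇒risingAbove≉0 x N px-binom≉0
      pd≉0′ : ∀ k → k ≤ N → ¬ risingAbove d k ≈ 0#
      pd≉0′ k k≤N = binom≉0⇒risingAbove≉0 d k (pd≉0 k k≤N)
      scale≉0 : ¬ scale N ≈ 0#
      scale≉0 = *-nonzero (*-nonzero (*-nonzero (*-nonzero (*-nonzero (charZero 1) px≉0) px≉0)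
                                                (pd≉0′ N ℕP.≤-refl))
                                     (risingAbove-nonzero e N E≉0))
                          W≉0
      ratio≈ : (binom (a + ι N) N * binom (e + ι N) N) ÷ (binom (x + ι N) N * binom (d + ι N) N)
               ≈ risingAbove a N * pe * (px ⁻¹ * pd ⁻¹)
      ratio≈ = ratio-cancel (binom≈risingAbove a N) (binom≈risingAbove e N) (binom≈risingAbove x N)
                            (binom≈risingAbove d N) (⁻¹-nonzero (ι-nonzero (ℕP.1≤n! N))) px≉0
                            (pd≉0′ N ℕP.≤-refl)

theorem5 : ∀ {c ℓ} (F : CharZeroField c ℓ) →
           let open CharZeroField F
               open FieldOps F
           in (n : ℕ) (x y : Carrier) →
              (∀ k → k ≤ n → ¬ (binom (ι 2 * x + ι n + ι k) k ≈ 0#)) →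
              (∀ k → k ≤ n → ¬ (binom (ι 2 * x - ι 2 * y + ι k) k ≈ 0#)) →
              (∀ k → k ≤ n → ¬ (1# + ι 2 * x + ι n + ι k ≈ 0#)) →
              (∀ j → suc j ≤ n → ¬ (x + ι (suc j) ≈ 0#)) →
              (∀ j → suc j ≤ n → ¬ ((x - ι 2 * y - 1#) + ι (suc j) ≈ 0#)) →
              ¬ (binom (x + ι n) n ≈ 0#) →
              ¬ (binom (ι 2 * x - ι 2 * y + ι n) n ≈ 0#) →
              sum0to n (λ k →
                  sgn k * choose n k
                  * ((binom (ι 2 * x + ι k) k * binom (ι 2 * y + ι k) k)
                     ÷ (binom (ι 2 * x + ι n + ι k) k * binom (ι 2 * x - ι 2 * y + ι k) k))
                  * ((1# + ι 2 * x + ι 2 * ι k) ÷ (1# + ι 2 * x + ι n + ι k))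
                  * H k x)
              ≈ (1# ÷ ι 2)
                * ((binom (ι 2 * x + ι n) n * binom (x - ι 2 * y - 1# + ι n) n)
                   ÷ (binom (x + ι n) n * binom (ι 2 * x - ι 2 * y + ι n) n))
                * (H n x - H n (x - ι 2 * y - 1#))
-- The last hypothesis is the instance k = n of the second one.
theorem5 F n x y pA≉0 pd≉0 D≉0 X≉0 E≉0 px≉0 _ =
  trans (sum-rescaled n pA≉0 pd≉0 D≉0) (closed-form n pd≉0 D≉0 X≉0 E≉0 px≉0)
  where
  open CharZeroField F using (trans)
  open FieldLemmas F
  open Sums x y
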